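{- Let $m\ge 1$, $k\ge 0$, $i\ge 0$ be integers. For integers $a,b,c$ put $p(a,b,c)=\binom{a+b}{c}\left\{ {a+b-c \atop b} \right\}_{\geq 2}$. Let $\Pi_0(m,k+1,i)$ be the set of partitions of $\{0,1,\ldots,m+k\}$ into exactly $i$ singleton blocks and exactly $k+1$ blocks of size at least $2$ (one of which necessarily contains $0$). Then \[ \sum_{j=i+1}^{m-k}\binom{j}{i}p(m,k,j) \;=\; |\Pi_0(m,k+1,i)| \;=\; (k+1)\,p(m-1,k+1,i)+(m+k)\,p(m-1,k,i). \]
   Context: For integers $n,k\ge0$, $\left\{ {n \atop k} \right\}_{\geq 2}$ is the number of partitions of an $n$-element set into $k$ blocks each having at least two elements (so it is $0$ if $2k>n$), with $\left\{ {0 \atop k} \right\}_{\geq 2}=\delta_{0k}$; it is taken to be $0$ when $n<0$ and $\binom{n}{c}=0$ when $c>n$ or $c<0$. Thus $p(a,b,c)$ is the number of partitions of $\{1,\ldots,a+b\}$ into $c$ singletons and $b$ blocks of size at least $2$. An empty sum equals $0$. -}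

module Defs where

open import Data.Nat using (ℕ; zero; suc; _+_; _*_; _∸_; _≤ᵇ_; _≡ᵇ_)
open import Data.Nat.Combinatorics using (_C_)
open import Data.Bool using (Bool; true; false; _∧_; if_then_else_)
open import Data.Fin using (Fin; toℕ)
import Data.Fin as Fin
open import Data.Vec using (Vec; []; _∷_; lookup)
open import Data.List using (List; []; _∷_; length; filterᵇ; map; concatMap; upTo; allFin)
open import Data.Bool.ListAction using (and)
open import Data.Nat.ListAction using (sum)

allVecs : (N n : ℕ) → List (Vec (Fin N) n)
allVecs N zero    = [] ∷ []
allVecs N (suc n) = concatMap (λ x → map (x ∷_) (allVecs N n)) (allFin N)

count : {A : Set} → (A → Bool) → List A → ℕ
count p xs = length (filterᵇ p xs)

_==_ : {N : ℕ} → Fin N → Fin N → Bool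
x == y = toℕ x ≡ᵇ toℕ y

-- A partition is encoded (bijectively) by the vector v that sends each
-- element x to the least element of the block containing x.  Such a
-- vector is exactly one with  v[x] ≤ x  and  v[v[x]] = v[x]  for all x;
-- its blocks are the fibres of v, indexed by the representatives r
-- with v[r] = r.

IsPartition : {N : ℕ} → Vec (Fin N) N → Bool
IsPartition {N} v =
  and (map (λ x → (toℕ (lookup v x) ≤ᵇ toℕ x) ∧ (lookup v (lookup v x) == lookup v x))
           (allFin N))

blockSize : {N : ℕ} → Vec (Fin N) N → Fin N → ℕ
blockSize {N} v r = count (λ y → lookup v y == r) (allFin N)

isRep : {N : ℕ} → Vec (Fin N) N → Fin N → Bool
isRep v r = lookup v r == r

numSingletons : {N : ℕ} → Vec (Fin N) N → ℕ
numSingletons {N} v = count (λ r → isRep v r ∧ (blockSize v r ≡ᵇ 1)) (allFin N)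

numBigBlocks : {N : ℕ} → Vec (Fin N) N → ℕ
numBigBlocks {N} v = count (λ r → isRep v r ∧ (2 ≤ᵇ blockSize v r)) (allFin N)

numPartitions : (N s b : ℕ) → ℕ
numPartitions N s b =
  count (λ v → IsPartition v ∧ (numSingletons v ≡ᵇ s) ∧ (numBigBlocks v ≡ᵇ b))
        (allVecs N N)

-- Associated Stirling numbers of the second kind {n over k}_{≥2}:
-- partitions of an n-set into k blocks, each of size ≥ 2.
-- (For n = 0 this gives δ_{0k}.)
S₂ : ℕ → ℕ → ℕ
S₂ n k = numPartitions n 0 k

-- p(a,b,c) = C(a+b, c) * {a+b-c over b}_{≥2}.  Arguments are natural
-- numbers here; when c > a+b the binomial factor is 0, so the truncated
-- subtraction a+b∸c is harmless.
p : ℕ → ℕ → ℕ → ℕ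
p a b c = ((a + b) C c) * S₂ (a + b ∸ c) b

-- |Π₀(m,k+1,i)|: partitions of {0,…,m+k} (an (m+k+1)-element set) into
-- exactly i singletons and exactly k+1 blocks of size ≥ 2.
-- As the paper indicates ("one of which necessarily contains 0"), the
-- element 0 lies in a block of size ≥ 2 (i.e. 0 is not a singleton).
Π₀card : ℕ → ℕ → ℕ → ℕ
Π₀card m k i =
  count (λ v → IsPartition v ∧ (numSingletons v ≡ᵇ i) ∧ (numBigBlocks v ≡ᵇ suc k)
                 ∧ (2 ≤ᵇ blockSize v (lookup v Fin.zero)))
        (allVecs (suc (m + k)) (suc (m + k)))

-- Σ_{j=lo}^{hi} f j  (empty, i.e. 0, when hi < lo)
sumFromTo : ℕ → ℕ → (ℕ → ℕ) → ℕ
sumFromTo lo hi f = sum (map (λ t → f (lo + t)) (upTo (suc hi ∸ lo)))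

-- A partition of {0, …, N} restricts to one of {0, …, N - 1}, to which N is added as a new singleton,
-- joined to a singleton, or joined to a larger block.  Counting by the number s of singletons and b of
-- blocks of size ≥ 2, this gives P(N+1, s, b) = P(N, s-1, b) + (s+1) P(N, s+1, b-1) + b P(N, s, b),
-- a recurrence also satisfied by C(N, s) {N-s over b}_{≥2}; so the two agree.  A partition having {0}
-- as a block arises only from such a partition, without joining N to {0}; so, counted by their other
-- singletons, the partitions of {0, …, N} having {0} as a block satisfy the same recurrence, and are
-- counted by P(N, ·, ·) as well.
-- Hence |Π₀(m, k+1, i)| = P(m+k+1, i, k+1) - P(m+k, i-1, k+1), which one step of the recurrence turns
-- into (i+1) P(m+k, i+1, k) + (k+1) P(m+k, i, k+1); absorption C(n+1, i+1)(i+1) = C(n, i)(n+1) gives the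
-- second identity.  For the first, C(j, i) C(n, j) = C(n, i) C(n-i, j-i) and
-- {M+1 over k+1}_{≥2} = Σ_{t ≥ 1} C(M, t) {M-t over k}_{≥2} (the block of a new element) reduce the sum
-- to C(m+k, i) {m+k-i+1 over k+1}_{≥2}, which is the same expression.

module Submission where

open import Defs
open import Data.Bool using (Bool; true; false; _∧_; not; T)
open import Data.Bool.ListAction using (and; all)
open import Data.Bool.Properties using (∧-assoc; ∧-zeroʳ; ∧-identityʳ)
open import Data.Empty using (⊥-elim)
open import Data.Fin using (Fin; toℕ; fromℕ; inject₁) renaming (zero to fzero; suc to fsuc)
open import Data.Fin.Properties using (toℕ-inject₁; toℕ-fromℕ; toℕ<n; toℕ≤pred[n]; toℕ-injective)
import Data.Fin.Properties as Fin
open import Data.List using (List; []; _∷_; _++_; map; concatMap; allFin; applyUpTo; upTo)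
open import Data.List.Properties using (map-++; map-∘; map-cong; map-tabulate)
open import Data.Nat
open import Data.Nat.Combinatorics using (_C_; nCk+nC[k+1]≡[n+1]C[k+1])
open import Data.Nat.ListAction using (sum)
open import Data.Nat.ListAction.Properties using (sum-++)
open import Data.Nat.Properties
open import Data.Nat.Tactic.RingSolver using (solve-∀)
open import Data.Product using (_×_; _,_; proj₁; proj₂)
open import Data.Vec using (Vec; []; _∷_; lookup; _∷ʳ_) renaming (map to vmap)
open import Data.Vec.Properties using (lookup-map)
open import Function using (_∘_; id)
open import Relation.Binary.PropositionalEquality
open import Relation.Nullary using (¬_; yes; no)
open import Algebra.Properties.CommutativeSemigroup +-commutativeSemigroup using (interchange; xy∙z≈xz∙y)
open import Algebra.Properties.CommutativeSemigroup *-commutativeSemigroup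
  using () renaming (x∙yz≈y∙xz to x*[y*z]≡y*[x*z])
open ≡-Reasoning

private
  variable
    A B : Set

⟦_⟧ : Bool → ℕ
⟦ true ⟧  = 1
⟦ false ⟧ = 0

∧≡true : ∀ {a b} → a ∧ b ≡ true → a ≡ true × b ≡ true
∧≡true {true} b≡true = refl , b≡true

⟦∧⟧ : ∀ a b → ⟦ a ∧ b ⟧ ≡ ⟦ a ⟧ * ⟦ b ⟧
⟦∧⟧ true  b = sym (+-identityʳ ⟦ b ⟧)
⟦∧⟧ false b = refl

⟦⟧*-cong : ∀ b {x y} → (b ≡ true → x ≡ y) → ⟦ b ⟧ * x ≡ ⟦ b ⟧ * y
⟦⟧*-cong true  x≡y = cong (1 *_) (x≡y refl)
⟦⟧*-cong false _   = refl

≡true : ∀ {b} → T b → b ≡ true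
≡true {true} _ = refl

≡false : ∀ {b} → ¬ T b → b ≡ false
≡false {false} _   = refl
≡false {true}  ¬tt = ⊥-elim (¬tt _)

∑ : List A → (A → ℕ) → ℕ
∑ xs f = sum (map f xs)

infix 6.5 ∑
syntax ∑ xs (λ x → e) = ∑[ x ∈ xs ] e

∑-cong : ∀ (xs : List A) {f g : A → ℕ} → (∀ x → f x ≡ g x) → ∑ xs f ≡ ∑ xs g
∑-cong xs f≗g = cong sum (map-cong f≗g xs)

∑-++ : ∀ (xs ys : List A) f → ∑ (xs ++ ys) f ≡ ∑ xs f + ∑ ys f
∑-++ xs ys f = trans (cong sum (map-++ f xs ys)) (sum-++ (map f xs) (map f ys))

∑-map : ∀ (g : A → B) xs (f : B → ℕ) → ∑ (map g xs) f ≡ ∑ xs (f ∘ g)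
∑-map g xs f = cong sum (sym (map-∘ xs))

∑-concatMap : ∀ (g : A → List B) xs (f : B → ℕ) → ∑ (concatMap g xs) f ≡ ∑[ x ∈ xs ] ∑ (g x) f
∑-concatMap g []       f = refl
∑-concatMap g (x ∷ xs) f = trans (∑-++ (g x) (concatMap g xs) f) (cong (∑ (g x) f +_) (∑-concatMap g xs f))

∑-zero : ∀ xs {f : A → ℕ} → (∀ x → f x ≡ 0) → ∑ xs f ≡ 0
∑-zero []       f≡0 = refl
∑-zero (x ∷ xs) f≡0 = cong₂ _+_ (f≡0 x) (∑-zero xs f≡0)

∑-distrib-+ : ∀ xs (f g : A → ℕ) → ∑[ x ∈ xs ] (f x + g x) ≡ ∑ xs f + ∑ xs g
∑-distrib-+ []       f g = refl
∑-distrib-+ (x ∷ xs) f g = trans (cong (f x + g x +_) (∑-distrib-+ xs f g)) (interchange (f x) (g x) _ _)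

*-distribˡ-∑ : ∀ c xs (f : A → ℕ) → c * ∑ xs f ≡ ∑[ x ∈ xs ] c * f x
*-distribˡ-∑ c []       f = *-zeroʳ c
*-distribˡ-∑ c (x ∷ xs) f = trans (*-distribˡ-+ c (f x) _) (cong (c * f x +_) (*-distribˡ-∑ c xs f))

count≡∑ : ∀ (p : A → Bool) xs → count p xs ≡ ∑[ x ∈ xs ] ⟦ p x ⟧
count≡∑ p []       = refl
count≡∑ p (x ∷ xs) with p x
... | true  = cong suc (count≡∑ p xs)
... | false = count≡∑ p xs

∑-⟦⟧*-const : ∀ (p : A → Bool) xs c → ∑[ x ∈ xs ] ⟦ p x ⟧ * c ≡ count p xs * c
∑-⟦⟧*-const p xs c = begin
  ∑[ x ∈ xs ] ⟦ p x ⟧ * c     ≡⟨ ∑-cong xs (λ x → *-comm ⟦ p x ⟧ c) ⟩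
  ∑[ x ∈ xs ] c * ⟦ p x ⟧     ≡⟨ *-distribˡ-∑ c xs _ ⟨
  c * (∑[ x ∈ xs ] ⟦ p x ⟧)   ≡⟨ cong (c *_) (count≡∑ p xs) ⟨
  c * count p xs              ≡⟨ *-comm c _ ⟩
  count p xs * c              ∎

∑-applyUpTo : ∀ (f : ℕ → A) n g → ∑ (applyUpTo f n) g ≡ ∑[ t ∈ upTo n ] g (f t)
∑-applyUpTo f zero    g = refl
∑-applyUpTo f (suc n) g = cong (g (f 0) +_) (trans (∑-applyUpTo (f ∘ suc) n g) (sym (∑-applyUpTo suc n (g ∘ f))))

∑-upTo-suc : ∀ n (g : ℕ → ℕ) → ∑[ t ∈ upTo (suc n) ] g t ≡ g 0 + ∑[ t ∈ upTo n ] g (suc t)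
∑-upTo-suc n g = cong (g 0 +_) (∑-applyUpTo suc n g)

∑-upTo-extend : ∀ {a b} (g : ℕ → ℕ) → a ≤ b → (∀ t → a ≤ t → g t ≡ 0) → ∑ (upTo a) g ≡ ∑ (upTo b) g
∑-upTo-extend {zero}  {zero}  g _         _      = refl
∑-upTo-extend {zero}  {suc b} g _         vanish = sym (trans (∑-upTo-suc b g)
  (cong₂ _+_ (vanish 0 z≤n) (sym (∑-upTo-extend {0} {b} (g ∘ suc) z≤n λ t _ → vanish (suc t) z≤n))))
∑-upTo-extend {suc a} {suc b} g (s≤s a≤b) vanish = trans (∑-upTo-suc a g)
  (trans (cong (g 0 +_) (∑-upTo-extend (g ∘ suc) a≤b λ t a≤t → vanish (suc t) (s≤s a≤t))) (sym (∑-upTo-suc b g)))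

==-refl : ∀ {n} (x : Fin n) → (x == x) ≡ true
==-refl x = ≡true (≡⇒≡ᵇ (toℕ x) (toℕ x) refl)

≢⇒==false : ∀ {n} {x y : Fin n} → x ≢ y → (x == y) ≡ false
≢⇒==false {x = x} {y} x≢y = ≡false (x≢y ∘ toℕ-injective ∘ ≡ᵇ⇒≡ (toℕ x) (toℕ y))

inject₁==inject₁ : ∀ {n} (x y : Fin n) → (inject₁ x == inject₁ y) ≡ (x == y)
inject₁==inject₁ x y = cong₂ _≡ᵇ_ (toℕ-inject₁ x) (toℕ-inject₁ y)

inject₁==fromℕ : ∀ {n} (x : Fin n) → (inject₁ x == fromℕ n) ≡ false
inject₁==fromℕ {n} x = ≢⇒==false {x = inject₁ x} (Fin.fromℕ≢inject₁ {n} {x} ∘ sym)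

fromℕ==inject₁ : ∀ {n} (x : Fin n) → (fromℕ n == inject₁ x) ≡ false
fromℕ==inject₁ {n} x = ≢⇒==false {x = fromℕ n} (Fin.fromℕ≢inject₁ {n} {x})

allFin-suc : ∀ n → allFin (suc n) ≡ fzero ∷ map fsuc (allFin n)
allFin-suc n = cong (fzero ∷_) (sym (map-tabulate id fsuc))

allFin-last : ∀ n → allFin (suc n) ≡ map inject₁ (allFin n) ++ fromℕ n ∷ []
allFin-last zero    = refl
allFin-last (suc n) = begin
  allFin (suc (suc n))                                          ≡⟨ allFin-suc (suc n) ⟩
  fzero ∷ map fsuc (allFin (suc n))                             ≡⟨ cong (λ xs → fzero ∷ map fsuc xs) (allFin-last n) ⟩
  fzero ∷ map fsuc (map inject₁ (allFin n) ++ fromℕ n ∷ [])     ≡⟨ cong (fzero ∷_) (map-++ fsuc (map inject₁ (allFin n)) _) ⟩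
  fzero ∷ map fsuc (map inject₁ (allFin n)) ++ fromℕ (suc n) ∷ [] ≡⟨ cong (λ xs → fzero ∷ xs ++ fromℕ (suc n) ∷ []) (trans (sym (map-∘ (allFin n))) (map-∘ (allFin n))) ⟩
  map inject₁ (fzero ∷ map fsuc (allFin n)) ++ fromℕ (suc n) ∷ [] ≡⟨ cong (λ xs → map inject₁ xs ++ fromℕ (suc n) ∷ []) (allFin-suc n) ⟨
  map inject₁ (allFin (suc n)) ++ fromℕ (suc n) ∷ []            ∎

∑-allFin-suc : ∀ n (f : Fin (suc n) → ℕ) → ∑ (allFin (suc n)) f ≡ f fzero + ∑ (allFin n) (f ∘ fsuc)
∑-allFin-suc n f = trans (cong (λ xs → ∑ xs f) (allFin-suc n)) (cong (f fzero +_) (∑-map fsuc (allFin n) f))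

∑-allFin-last : ∀ n (f : Fin (suc n) → ℕ) → ∑ (allFin (suc n)) f ≡ ∑ (allFin n) (f ∘ inject₁) + f (fromℕ n)
∑-allFin-last n f = begin
  ∑ (allFin (suc n)) f                                 ≡⟨ cong (λ xs → ∑ xs f) (allFin-last n) ⟩
  ∑ (map inject₁ (allFin n) ++ fromℕ n ∷ []) f         ≡⟨ ∑-++ (map inject₁ (allFin n)) _ f ⟩
  ∑ (map inject₁ (allFin n)) f + (f (fromℕ n) + 0)     ≡⟨ cong₂ _+_ (∑-map inject₁ (allFin n) f) (+-identityʳ _) ⟩
  ∑ (allFin n) (f ∘ inject₁) + f (fromℕ n)             ∎

term≤∑ : ∀ n (f : Fin n → ℕ) r → f r ≤ ∑ (allFin n) f
term≤∑ (suc n) f fzero    rewrite ∑-allFin-suc n f = m≤m+n (f fzero) _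
term≤∑ (suc n) f (fsuc r) rewrite ∑-allFin-suc n f = ≤-trans (term≤∑ n (f ∘ fsuc) r) (m≤n+m _ (f fzero))

∑-agree-except : ∀ n (f g : Fin n → ℕ) r → (∀ x → x ≢ r → f x ≡ g x) →
  ∑ (allFin n) f + g r ≡ ∑ (allFin n) g + f r
∑-agree-except (suc n) f g fzero f≗g rewrite ∑-allFin-suc n f | ∑-allFin-suc n g
  | ∑-cong (allFin n) (λ x → f≗g (fsuc x) λ ()) = rotate (f fzero) _ (g fzero)
  where
  rotate : ∀ a b c → a + b + c ≡ c + b + a
  rotate = solve-∀
∑-agree-except (suc n) f g (fsuc r) f≗g rewrite ∑-allFin-suc n f | ∑-allFin-suc n g
  | f≗g fzero (λ ()) | +-assoc (g fzero) (∑ (allFin n) (f ∘ fsuc)) (g (fsuc r))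
  | ∑-agree-except n (f ∘ fsuc) (g ∘ fsuc) r (λ x x≢r → f≗g (fsuc x) (x≢r ∘ Fin.suc-injective)) =
  sym (+-assoc (g fzero) _ _)

count-except : ∀ n (p : Fin n → Bool) r₀ → count (λ r → p r ∧ not (r == r₀)) (allFin n) + ⟦ p r₀ ⟧ ≡ count p (allFin n)
count-except n p r₀ = begin
  count (λ r → p r ∧ not (r == r₀)) (allFin n) + ⟦ p r₀ ⟧
    ≡⟨ cong (_+ ⟦ p r₀ ⟧) (count≡∑ _ (allFin n)) ⟩
  (∑[ r ∈ allFin n ] ⟦ p r ∧ not (r == r₀) ⟧) + ⟦ p r₀ ⟧
    ≡⟨ ∑-agree-except n _ _ r₀ (λ r r≢r₀ → trans (cong (λ b → ⟦ p r ∧ not b ⟧) (≢⇒==false r≢r₀)) (cong ⟦_⟧ (∧-identityʳ (p r)))) ⟩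
  (∑[ r ∈ allFin n ] ⟦ p r ⟧) + ⟦ p r₀ ∧ not (r₀ == r₀) ⟧
    ≡⟨ cong (λ b → (∑[ r ∈ allFin n ] ⟦ p r ⟧) + ⟦ p r₀ ∧ not b ⟧) (==-refl r₀) ⟩
  (∑[ r ∈ allFin n ] ⟦ p r ⟧) + ⟦ p r₀ ∧ false ⟧
    ≡⟨ cong (λ b → (∑[ r ∈ allFin n ] ⟦ p r ⟧) + ⟦ b ⟧) (∧-zeroʳ (p r₀)) ⟩
  (∑[ r ∈ allFin n ] ⟦ p r ⟧) + 0
    ≡⟨ trans (+-identityʳ _) (sym (count≡∑ p (allFin n))) ⟩
  count p (allFin n) ∎

all-allFin-suc : ∀ n (φ : Fin (suc n) → Bool) → all φ (allFin (suc n)) ≡ φ fzero ∧ all (φ ∘ fsuc) (allFin n)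
all-allFin-suc n φ = trans (cong (and ∘ map φ) (allFin-suc n)) (cong (λ xs → φ fzero ∧ and xs) (sym (map-∘ (allFin n))))

all-allFin-last : ∀ n (φ : Fin (suc n) → Bool) → all φ (allFin (suc n)) ≡ all (φ ∘ inject₁) (allFin n) ∧ φ (fromℕ n)
all-allFin-last n φ = begin
  and (map φ (allFin (suc n)))                                      ≡⟨ cong (and ∘ map φ) (allFin-last n) ⟩
  and (map φ (map inject₁ (allFin n) ++ fromℕ n ∷ []))              ≡⟨ cong and (map-++ φ (map inject₁ (allFin n)) _) ⟩
  and (map φ (map inject₁ (allFin n)) ++ φ (fromℕ n) ∷ [])          ≡⟨ and-++ (map φ (map inject₁ (allFin n))) _ ⟩
  and (map φ (map inject₁ (allFin n))) ∧ (φ (fromℕ n) ∧ true)       ≡⟨ cong₂ _∧_ (cong and (sym (map-∘ (allFin n)))) (∧-identityʳ _) ⟩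
  all (φ ∘ inject₁) (allFin n) ∧ φ (fromℕ n)                        ∎
  where
  and-++ : ∀ xs ys → and (xs ++ ys) ≡ and xs ∧ and ys
  and-++ []       ys = refl
  and-++ (x ∷ xs) ys = trans (cong (x ∧_) (and-++ xs ys)) (sym (∧-assoc x (and xs) (and ys)))

all-allFin⇒ : ∀ n (φ : Fin n → Bool) → all φ (allFin n) ≡ true → ∀ x → φ x ≡ true
all-allFin⇒ (suc n) φ all≡true x with ∧≡true {φ fzero} (trans (sym (all-allFin-suc n φ)) all≡true)
all-allFin⇒ (suc n) φ all≡true fzero    | φ0 , _  = φ0
all-allFin⇒ (suc n) φ all≡true (fsuc x) | _  , φs = all-allFin⇒ n (φ ∘ fsuc) φs x

∑-allVecs-suc : ∀ N n (g : Vec (Fin N) (suc n) → ℕ) →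
  ∑ (allVecs N (suc n)) g ≡ ∑[ x ∈ allFin N ] ∑[ w ∈ allVecs N n ] g (x ∷ w)
∑-allVecs-suc N n g = trans (∑-concatMap (λ x → map (x ∷_) (allVecs N n)) (allFin N) g)
                            (∑-cong (allFin N) (λ x → ∑-map (x ∷_) (allVecs N n) g))

∑-allVecs-snoc : ∀ N n (g : Vec (Fin N) (suc n) → ℕ) →
  ∑ (allVecs N (suc n)) g ≡ ∑[ w ∈ allVecs N n ] ∑[ y ∈ allFin N ] g (w ∷ʳ y)
∑-allVecs-snoc N zero    g = trans (∑-allVecs-suc N zero g)
  (trans (∑-cong (allFin N) (λ y → +-identityʳ (g (y ∷ [])))) (sym (+-identityʳ _)))
∑-allVecs-snoc N (suc n) g = begin
  ∑ (allVecs N (suc (suc n))) g                                         ≡⟨ ∑-allVecs-suc N (suc n) g ⟩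
  ∑[ x ∈ allFin N ] ∑[ w ∈ allVecs N (suc n) ] g (x ∷ w)                ≡⟨ ∑-cong (allFin N) (λ x → ∑-allVecs-snoc N n (g ∘ (x ∷_))) ⟩
  ∑[ x ∈ allFin N ] ∑[ w ∈ allVecs N n ] ∑[ y ∈ allFin N ] g (x ∷ (w ∷ʳ y)) ≡⟨ ∑-allVecs-suc N n _ ⟨
  ∑[ w ∈ allVecs N (suc n) ] ∑[ y ∈ allFin N ] g (w ∷ʳ y)               ∎

∑-allVecs-inject₁ : ∀ N n (g : Vec (Fin (suc N)) n → ℕ) → (∀ w i → lookup w i ≡ fromℕ N → g w ≡ 0) →
  ∑ (allVecs (suc N) n) g ≡ ∑[ w ∈ allVecs N n ] g (vmap inject₁ w)
∑-allVecs-inject₁ N zero    g vanish = refl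
∑-allVecs-inject₁ N (suc n) g vanish = begin
  ∑ (allVecs (suc N) (suc n)) g
    ≡⟨ ∑-allVecs-suc (suc N) n g ⟩
  ∑[ x ∈ allFin (suc N) ] ∑[ w ∈ allVecs (suc N) n ] g (x ∷ w)
    ≡⟨ ∑-allFin-last N _ ⟩
  (∑[ x ∈ allFin N ] ∑[ w ∈ allVecs (suc N) n ] g (inject₁ x ∷ w)) + (∑[ w ∈ allVecs (suc N) n ] g (fromℕ N ∷ w))
    ≡⟨ cong₂ _+_ (∑-cong (allFin N) (λ x → ∑-allVecs-inject₁ N n (g ∘ (inject₁ x ∷_)) (λ w i → vanish _ (fsuc i))))
                 (∑-zero (allVecs (suc N) n) (λ w → vanish _ fzero refl)) ⟩
  (∑[ x ∈ allFin N ] ∑[ w ∈ allVecs N n ] g (inject₁ x ∷ vmap inject₁ w)) + 0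
    ≡⟨ +-identityʳ _ ⟩
  ∑[ x ∈ allFin N ] ∑[ w ∈ allVecs N n ] g (vmap inject₁ (x ∷ w))
    ≡⟨ ∑-allVecs-suc N n _ ⟨
  ∑[ w ∈ allVecs N (suc n) ] g (vmap inject₁ w) ∎

-- Adding an element to a partition

-- Adds the element N with representative y: a new singleton if y = N, otherwise joined to the block of y.
extend : ∀ {N} → Vec (Fin N) N → Fin (suc N) → Vec (Fin (suc N)) (suc N)
extend w y = vmap inject₁ w ∷ʳ y

lookup-∷ʳ-inject₁ : ∀ {n} (u : Vec B n) y i → lookup (u ∷ʳ y) (inject₁ i) ≡ lookup u i
lookup-∷ʳ-inject₁ (x ∷ u) y fzero    = refl
lookup-∷ʳ-inject₁ (x ∷ u) y (fsuc i) = lookup-∷ʳ-inject₁ u y i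

lookup-∷ʳ-last : ∀ {n} (u : Vec B n) y → lookup (u ∷ʳ y) (fromℕ n) ≡ y
lookup-∷ʳ-last []      y = refl
lookup-∷ʳ-last (x ∷ u) y = lookup-∷ʳ-last u y

module _ {N} (w : Vec (Fin N) N) (y : Fin (suc N)) where

  lookup-extend-inject₁ : ∀ i → lookup (extend w y) (inject₁ i) ≡ inject₁ (lookup w i)
  lookup-extend-inject₁ i = trans (lookup-∷ʳ-inject₁ (vmap inject₁ w) y i) (lookup-map i inject₁ w)

  lookup-extend-last : lookup (extend w y) (fromℕ N) ≡ y
  lookup-extend-last = lookup-∷ʳ-last (vmap inject₁ w) y

  isRep-extend-inject₁ : ∀ r → isRep (extend w y) (inject₁ r) ≡ isRep w r
  isRep-extend-inject₁ r = trans (cong (_== inject₁ r) (lookup-extend-inject₁ r)) (inject₁==inject₁ (lookup w r) r)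

  isRep-extend-last : isRep (extend w y) (fromℕ N) ≡ (y == fromℕ N)
  isRep-extend-last = cong (_== fromℕ N) lookup-extend-last

  blockSize-extend-inject₁ : ∀ r → blockSize (extend w y) (inject₁ r) ≡ blockSize w r + ⟦ y == inject₁ r ⟧
  blockSize-extend-inject₁ r = begin
    blockSize (extend w y) (inject₁ r)
      ≡⟨ count≡∑ _ (allFin (suc N)) ⟩
    ∑[ x ∈ allFin (suc N) ] ⟦ lookup (extend w y) x == inject₁ r ⟧
      ≡⟨ ∑-allFin-last N _ ⟩
    (∑[ x ∈ allFin N ] ⟦ lookup (extend w y) (inject₁ x) == inject₁ r ⟧) + ⟦ lookup (extend w y) (fromℕ N) == inject₁ r ⟧
      ≡⟨ cong₂ _+_ (∑-cong (allFin N) λ x → cong ⟦_⟧ (trans (cong (_== inject₁ r) (lookup-extend-inject₁ x))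
                                                            (inject₁==inject₁ (lookup w x) r)))
                   (cong (λ z → ⟦ z == inject₁ r ⟧) lookup-extend-last) ⟩
    (∑[ x ∈ allFin N ] ⟦ lookup w x == r ⟧) + ⟦ y == inject₁ r ⟧
      ≡⟨ cong (_+ ⟦ y == inject₁ r ⟧) (count≡∑ _ (allFin N)) ⟨
    blockSize w r + ⟦ y == inject₁ r ⟧ ∎

  blockSize-extend-last : blockSize (extend w y) (fromℕ N) ≡ ⟦ y == fromℕ N ⟧
  blockSize-extend-last = begin
    blockSize (extend w y) (fromℕ N)
      ≡⟨ count≡∑ _ (allFin (suc N)) ⟩
    ∑[ x ∈ allFin (suc N) ] ⟦ lookup (extend w y) x == fromℕ N ⟧
      ≡⟨ ∑-allFin-last N _ ⟩
    (∑[ x ∈ allFin N ] ⟦ lookup (extend w y) (inject₁ x) == fromℕ N ⟧) + ⟦ lookup (extend w y) (fromℕ N) == fromℕ N ⟧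
      ≡⟨ cong₂ _+_ (∑-zero (allFin N) λ x → cong ⟦_⟧ (trans (cong (_== fromℕ N) (lookup-extend-inject₁ x))
                                                            (inject₁==fromℕ (lookup w x))))
                   (cong (λ z → ⟦ z == fromℕ N ⟧) lookup-extend-last) ⟩
    ⟦ y == fromℕ N ⟧ ∎

blockCount : ∀ {N} → (Bool → ℕ → Bool) → Vec (Fin N) N → ℕ
blockCount {N} F v = ∑[ r ∈ allFin N ] ⟦ F (isRep v r) (blockSize v r) ⟧

numSingletons≡blockCount : ∀ {N} (v : Vec (Fin N) N) → numSingletons v ≡ blockCount (λ a c → a ∧ (c ≡ᵇ 1)) v
numSingletons≡blockCount {N} v = count≡∑ _ (allFin N)

numBigBlocks≡blockCount : ∀ {N} (v : Vec (Fin N) N) → numBigBlocks v ≡ blockCount (λ a c → a ∧ (2 ≤ᵇ c)) v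
numBigBlocks≡blockCount {N} v = count≡∑ _ (allFin N)

module _ {N} (F : Bool → ℕ → Bool) (w : Vec (Fin N) N) where

  blockCount-extend : ∀ y → blockCount F (extend w y) ≡
    (∑[ r ∈ allFin N ] ⟦ F (isRep w r) (blockSize w r + ⟦ y == inject₁ r ⟧) ⟧) + ⟦ F (y == fromℕ N) ⟦ y == fromℕ N ⟧ ⟧
  blockCount-extend y = trans (∑-allFin-last N _)
    (cong₂ _+_ (∑-cong (allFin N) λ r → cong₂ (λ a c → ⟦ F a c ⟧) (isRep-extend-inject₁ w y r) (blockSize-extend-inject₁ w y r))
               (cong₂ (λ a c → ⟦ F a c ⟧) (isRep-extend-last w y) (blockSize-extend-last w y)))

  blockCount-newBlock : blockCount F (extend w (fromℕ N)) ≡ blockCount F w + ⟦ F true 1 ⟧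
  blockCount-newBlock = begin
    blockCount F (extend w (fromℕ N))
      ≡⟨ blockCount-extend (fromℕ N) ⟩
    (∑[ r ∈ allFin N ] ⟦ F (isRep w r) (blockSize w r + ⟦ fromℕ N == inject₁ r ⟧) ⟧) + ⟦ F (fromℕ N == fromℕ N) ⟦ fromℕ N == fromℕ N ⟧ ⟧
      ≡⟨ cong₂ _+_ (∑-cong (allFin N) λ r → cong (λ c → ⟦ F (isRep w r) c ⟧)
                                            (trans (cong (λ b → blockSize w r + ⟦ b ⟧) (fromℕ==inject₁ r)) (+-identityʳ _)))
                   (cong (λ b → ⟦ F b ⟦ b ⟧ ⟧) (==-refl (fromℕ N))) ⟩
    blockCount F w + ⟦ F true 1 ⟧ ∎

  blockCount-join : ∀ r → isRep w r ≡ true →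
    blockCount F (extend w (inject₁ r)) + ⟦ F true (blockSize w r) ⟧ ≡ blockCount F w + ⟦ F true (suc (blockSize w r)) ⟧ + ⟦ F false 0 ⟧
  blockCount-join r rep = begin
    blockCount F (extend w (inject₁ r)) + ⟦ F true (blockSize w r) ⟧
      ≡⟨ cong (_+ ⟦ F true (blockSize w r) ⟧) (blockCount-extend (inject₁ r)) ⟩
    ∑ (allFin N) joined + ⟦ F (inject₁ r == fromℕ N) ⟦ inject₁ r == fromℕ N ⟧ ⟧ + ⟦ F true (blockSize w r) ⟧
      ≡⟨ cong (λ b → ∑ (allFin N) joined + ⟦ F b ⟦ b ⟧ ⟧ + ⟦ F true (blockSize w r) ⟧) (inject₁==fromℕ r) ⟩
    ∑ (allFin N) joined + ⟦ F false 0 ⟧ + ⟦ F true (blockSize w r) ⟧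
      ≡⟨ xy∙z≈xz∙y (∑ (allFin N) joined) _ _ ⟩
    ∑ (allFin N) joined + ⟦ F true (blockSize w r) ⟧ + ⟦ F false 0 ⟧
      ≡⟨ cong (λ b → ∑ (allFin N) joined + ⟦ F b (blockSize w r) ⟧ + ⟦ F false 0 ⟧) (sym rep) ⟩
    ∑ (allFin N) joined + unjoined r + ⟦ F false 0 ⟧
      ≡⟨ cong (_+ ⟦ F false 0 ⟧) (∑-agree-except N joined unjoined r agree) ⟩
    blockCount F w + joined r + ⟦ F false 0 ⟧
      ≡⟨ cong (λ b → blockCount F w + ⟦ F b (blockSize w r + ⟦ inject₁ r == inject₁ r ⟧) ⟧ + ⟦ F false 0 ⟧) rep ⟩
    blockCount F w + ⟦ F true (blockSize w r + ⟦ inject₁ r == inject₁ r ⟧) ⟧ + ⟦ F false 0 ⟧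
      ≡⟨ cong (λ b → blockCount F w + ⟦ F true (blockSize w r + ⟦ b ⟧) ⟧ + ⟦ F false 0 ⟧) (==-refl (inject₁ r)) ⟩
    blockCount F w + ⟦ F true (blockSize w r + 1) ⟧ + ⟦ F false 0 ⟧
      ≡⟨ cong (λ c → blockCount F w + ⟦ F true c ⟧ + ⟦ F false 0 ⟧) (+-comm (blockSize w r) 1) ⟩
    blockCount F w + ⟦ F true (suc (blockSize w r)) ⟧ + ⟦ F false 0 ⟧ ∎
    where
    joined unjoined : Fin N → ℕ
    joined   x = ⟦ F (isRep w x) (blockSize w x + ⟦ inject₁ r == inject₁ x ⟧) ⟧
    unjoined x = ⟦ F (isRep w x) (blockSize w x) ⟧
    agree : ∀ x → x ≢ r → joined x ≡ unjoined x
    agree x x≢r = cong (λ c → ⟦ F (isRep w x) c ⟧)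
      (trans (cong (λ b → blockSize w x + ⟦ b ⟧) (trans (inject₁==inject₁ r x) (≢⇒==false (x≢r ∘ sym)))) (+-identityʳ _))

module _ {N} (w : Vec (Fin N) N) where

  numSingletons-newBlock : numSingletons (extend w (fromℕ N)) ≡ suc (numSingletons w)
  numSingletons-newBlock = begin
    numSingletons (extend w (fromℕ N))                    ≡⟨ numSingletons≡blockCount (extend w (fromℕ N)) ⟩
    blockCount (λ a c → a ∧ (c ≡ᵇ 1)) (extend w (fromℕ N)) ≡⟨ blockCount-newBlock (λ a c → a ∧ (c ≡ᵇ 1)) w ⟩
    blockCount (λ a c → a ∧ (c ≡ᵇ 1)) w + 1                ≡⟨ cong (_+ 1) (numSingletons≡blockCount w) ⟨
    numSingletons w + 1                                   ≡⟨ +-comm (numSingletons w) 1 ⟩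
    suc (numSingletons w)                                 ∎

  numBigBlocks-newBlock : numBigBlocks (extend w (fromℕ N)) ≡ numBigBlocks w
  numBigBlocks-newBlock = begin
    numBigBlocks (extend w (fromℕ N))                     ≡⟨ numBigBlocks≡blockCount (extend w (fromℕ N)) ⟩
    blockCount (λ a c → a ∧ (2 ≤ᵇ c)) (extend w (fromℕ N)) ≡⟨ blockCount-newBlock (λ a c → a ∧ (2 ≤ᵇ c)) w ⟩
    blockCount (λ a c → a ∧ (2 ≤ᵇ c)) w + 0                ≡⟨ +-identityʳ _ ⟩
    blockCount (λ a c → a ∧ (2 ≤ᵇ c)) w                    ≡⟨ numBigBlocks≡blockCount w ⟨
    numBigBlocks w                                        ∎

  module _ (r : Fin N) (rep : isRep w r ≡ true) where

    private
      singletons-join : ∀ {c} → blockSize w r ≡ c →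
        numSingletons (extend w (inject₁ r)) + ⟦ c ≡ᵇ 1 ⟧ ≡ numSingletons w + ⟦ suc c ≡ᵇ 1 ⟧ + 0
      singletons-join refl rewrite numSingletons≡blockCount (extend w (inject₁ r)) | numSingletons≡blockCount w =
        blockCount-join (λ a c → a ∧ (c ≡ᵇ 1)) w r rep

      bigBlocks-join : ∀ {c} → blockSize w r ≡ c →
        numBigBlocks (extend w (inject₁ r)) + ⟦ 2 ≤ᵇ c ⟧ ≡ numBigBlocks w + ⟦ 2 ≤ᵇ suc c ⟧ + 0
      bigBlocks-join refl rewrite numBigBlocks≡blockCount (extend w (inject₁ r)) | numBigBlocks≡blockCount w =
        blockCount-join (λ a c → a ∧ (2 ≤ᵇ c)) w r rep

    joinSingleton-stats : blockSize w r ≡ 1 →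
      numSingletons (extend w (inject₁ r)) ≡ pred (numSingletons w) × numBigBlocks (extend w (inject₁ r)) ≡ suc (numBigBlocks w)
    joinSingleton-stats size≡1 =
      cong pred (trans (+-comm 1 _) (trans (singletons-join size≡1) (trans (+-identityʳ _) (+-identityʳ _)))) ,
      trans (sym (+-identityʳ _)) (trans (bigBlocks-join size≡1) (trans (+-identityʳ _) (+-comm _ 1)))

    joinBig-stats : ∀ {c} → blockSize w r ≡ suc (suc c) →
      numSingletons (extend w (inject₁ r)) ≡ numSingletons w × numBigBlocks (extend w (inject₁ r)) ≡ numBigBlocks w
    joinBig-stats size≡2+c =
      trans (sym (+-identityʳ _)) (trans (singletons-join size≡2+c) (trans (+-identityʳ _) (+-identityʳ _))) ,
      suc-injective (trans (+-comm 1 _) (trans (bigBlocks-join size≡2+c) (trans (+-identityʳ _) (+-comm _ 1))))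

blockSize-rep : ∀ {N} (v : Vec (Fin N) N) r → isRep v r ≡ true → 1 ≤ blockSize v r
blockSize-rep {N} v r rep =
  subst₂ _≤_ (cong ⟦_⟧ rep) (sym (count≡∑ _ (allFin N))) (term≤∑ N (λ x → ⟦ lookup v x == r ⟧) r)

module _ {N} (w : Vec (Fin N) N) where

  IsPartition-extend : ∀ y → IsPartition (extend w y) ≡ IsPartition w ∧ (lookup (extend w y) y == y)
  IsPartition-extend y = trans (all-allFin-last N _) (cong₂ _∧_ (cong and (map-cong old-point (allFin N))) new-point)
    where
    u = extend w y
    old-point : ∀ x → ((toℕ (lookup u (inject₁ x)) ≤ᵇ toℕ (inject₁ x)) ∧ (lookup u (lookup u (inject₁ x)) == lookup u (inject₁ x)))
                    ≡ ((toℕ (lookup w x) ≤ᵇ toℕ x) ∧ (lookup w (lookup w x) == lookup w x))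
    old-point x rewrite lookup-extend-inject₁ w y x | lookup-extend-inject₁ w y (lookup w x)
      | toℕ-inject₁ x | toℕ-inject₁ (lookup w x) | toℕ-inject₁ (lookup w (lookup w x)) = refl
    new-point : ((toℕ (lookup u (fromℕ N)) ≤ᵇ toℕ (fromℕ N)) ∧ (lookup u (lookup u (fromℕ N)) == lookup u (fromℕ N)))
              ≡ (lookup u y == y)
    new-point rewrite lookup-extend-last w y | toℕ-fromℕ N | ≡true (≤⇒≤ᵇ (toℕ≤pred[n] y)) = refl

  IsPartition-newBlock : IsPartition (extend w (fromℕ N)) ≡ IsPartition w
  IsPartition-newBlock = begin
    IsPartition (extend w (fromℕ N))                                              ≡⟨ IsPartition-extend (fromℕ N) ⟩
    IsPartition w ∧ (lookup (extend w (fromℕ N)) (fromℕ N) == fromℕ N)            ≡⟨ cong (λ z → IsPartition w ∧ (z == fromℕ N)) (lookup-extend-last w (fromℕ N)) ⟩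
    IsPartition w ∧ (fromℕ N == fromℕ N)                                          ≡⟨ cong (IsPartition w ∧_) (==-refl (fromℕ N)) ⟩
    IsPartition w ∧ true                                                          ≡⟨ ∧-identityʳ _ ⟩
    IsPartition w                                                                 ∎

  IsPartition-join : ∀ r → IsPartition (extend w (inject₁ r)) ≡ IsPartition w ∧ isRep w r
  IsPartition-join r = trans (IsPartition-extend (inject₁ r)) (cong (IsPartition w ∧_) (isRep-extend-inject₁ w (inject₁ r) r))

IsPartition-∷ʳ-∋last : ∀ {M} (w : Vec (Fin (suc M)) M) y i → lookup w i ≡ fromℕ M → IsPartition (w ∷ʳ y) ≡ false
IsPartition-∷ʳ-∋last {M} w y i wᵢ≡M with IsPartition (w ∷ʳ y) in isPart
... | false = refl
... | true  = ⊥-elim (<⇒≱ (toℕ<n i) (subst₂ _≤_ Mᵢ≡M (toℕ-inject₁ i) (≤ᵇ⇒≤ _ _ (subst T (sym monotone) _))))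
  where
  monotone : (toℕ (lookup (w ∷ʳ y) (inject₁ i)) ≤ᵇ toℕ (inject₁ i)) ≡ true
  monotone = proj₁ (∧≡true (all-allFin⇒ (suc M) _ isPart (inject₁ i)))
  Mᵢ≡M : toℕ (lookup (w ∷ʳ y) (inject₁ i)) ≡ M
  Mᵢ≡M = trans (cong toℕ (trans (lookup-∷ʳ-inject₁ w y i) wᵢ≡M)) (toℕ-fromℕ M)

-- A partition of Fin (suc M) restricts to one of Fin M, to which the new element is added either as
-- a singleton or joined to the block of some representative r.
∑-extensions : ∀ {M} (w : Vec (Fin M) M) (G : Vec (Fin (suc M)) (suc M) → ℕ) →
  ∑[ y ∈ allFin (suc M) ] ⟦ IsPartition (extend w y) ⟧ * G (extend w y) ≡
  ⟦ IsPartition w ⟧ * (G (extend w (fromℕ M)) + ∑[ r ∈ allFin M ] ⟦ isRep w r ⟧ * G (extend w (inject₁ r)))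
∑-extensions {M} w G = begin
  ∑[ y ∈ allFin (suc M) ] ⟦ IsPartition (extend w y) ⟧ * G (extend w y)
    ≡⟨ ∑-allFin-last M _ ⟩
  (∑[ r ∈ allFin M ] ⟦ IsPartition (extend w (inject₁ r)) ⟧ * G (extend w (inject₁ r))) + ⟦ IsPartition (extend w (fromℕ M)) ⟧ * new
    ≡⟨ cong₂ _+_ (∑-cong (allFin M) joined) (cong (λ b → ⟦ b ⟧ * new) (IsPartition-newBlock w)) ⟩
  (∑[ r ∈ allFin M ] ⟦ IsPartition w ⟧ * (⟦ isRep w r ⟧ * G (extend w (inject₁ r)))) + ⟦ IsPartition w ⟧ * new
    ≡⟨ cong (_+ ⟦ IsPartition w ⟧ * new) (*-distribˡ-∑ ⟦ IsPartition w ⟧ (allFin M) _) ⟨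
  ⟦ IsPartition w ⟧ * (∑[ r ∈ allFin M ] ⟦ isRep w r ⟧ * G (extend w (inject₁ r))) + ⟦ IsPartition w ⟧ * new
    ≡⟨ +-comm (⟦ IsPartition w ⟧ * (∑[ r ∈ allFin M ] ⟦ isRep w r ⟧ * G (extend w (inject₁ r)))) _ ⟩
  ⟦ IsPartition w ⟧ * new + ⟦ IsPartition w ⟧ * (∑[ r ∈ allFin M ] ⟦ isRep w r ⟧ * G (extend w (inject₁ r)))
    ≡⟨ *-distribˡ-+ ⟦ IsPartition w ⟧ _ _ ⟨
  ⟦ IsPartition w ⟧ * (new + ∑[ r ∈ allFin M ] ⟦ isRep w r ⟧ * G (extend w (inject₁ r))) ∎
  where
  new = G (extend w (fromℕ M))
  joined : ∀ r → ⟦ IsPartition (extend w (inject₁ r)) ⟧ * G (extend w (inject₁ r)) ≡ ⟦ IsPartition w ⟧ * (⟦ isRep w r ⟧ * G (extend w (inject₁ r)))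
  joined r = trans (cong (λ b → ⟦ b ⟧ * G (extend w (inject₁ r))) (IsPartition-join w r))
                   (trans (cong (_* G (extend w (inject₁ r))) (⟦∧⟧ (IsPartition w) (isRep w r))) (*-assoc ⟦ IsPartition w ⟧ ⟦ isRep w r ⟧ _))

∑-partitions-suc : ∀ M (G : Vec (Fin (suc M)) (suc M) → ℕ) →
  ∑[ v ∈ allVecs (suc M) (suc M) ] ⟦ IsPartition v ⟧ * G v ≡
  ∑[ w ∈ allVecs M M ] ⟦ IsPartition w ⟧ * (G (extend w (fromℕ M)) + ∑[ r ∈ allFin M ] ⟦ isRep w r ⟧ * G (extend w (inject₁ r)))
∑-partitions-suc M G = begin
  ∑[ v ∈ allVecs (suc M) (suc M) ] weight v                            ≡⟨ ∑-allVecs-snoc (suc M) M weight ⟩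
  ∑[ u ∈ allVecs (suc M) M ] ∑[ y ∈ allFin (suc M) ] weight (u ∷ʳ y)   ≡⟨ ∑-allVecs-inject₁ M M _ vanish ⟩
  ∑[ w ∈ allVecs M M ] ∑[ y ∈ allFin (suc M) ] weight (extend w y)     ≡⟨ ∑-cong (allVecs M M) (λ w → ∑-extensions w G) ⟩
  ∑[ w ∈ allVecs M M ] ⟦ IsPartition w ⟧ * (G (extend w (fromℕ M)) + ∑[ r ∈ allFin M ] ⟦ isRep w r ⟧ * G (extend w (inject₁ r))) ∎
  where
  weight : Vec (Fin (suc M)) (suc M) → ℕ
  weight v = ⟦ IsPartition v ⟧ * G v
  vanish : ∀ u i → lookup u i ≡ fromℕ M → ∑[ y ∈ allFin (suc M) ] weight (u ∷ʳ y) ≡ 0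
  vanish u i uᵢ≡M = ∑-zero (allFin (suc M)) λ y → cong (λ b → ⟦ b ⟧ * G (u ∷ʳ y)) (IsPartition-∷ʳ-∋last u y i uᵢ≡M)

-- The recurrence for partitions by singletons and blocks of size ≥ 2

-- If c s b counts partitions of a set by s singletons and b blocks of size ≥ 2, then addElement c does
-- so after adding an element, which is a new singleton, joins one of s + 1 singletons, or joins one of
-- b larger blocks.
newSingleton joinSingleton addElement : (ℕ → ℕ → ℕ) → ℕ → ℕ → ℕ
newSingleton c zero    b = 0
newSingleton c (suc s) b = c s b

joinSingleton c s zero    = 0
joinSingleton c s (suc b) = suc s * c (suc s) b

addElement c s b = newSingleton c s b + joinSingleton c s b + b * c s b

module _ {c d : ℕ → ℕ → ℕ} (c≗d : ∀ s b → c s b ≡ d s b) where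

  newSingleton-cong : ∀ s b → newSingleton c s b ≡ newSingleton d s b
  newSingleton-cong zero    b = refl
  newSingleton-cong (suc s) b = c≗d s b

  addElement-cong : ∀ s b → addElement c s b ≡ addElement d s b
  addElement-cong s b = cong₂ _+_ (cong₂ _+_ (newSingleton-cong s b) (join b)) (cong (b *_) (c≗d s b))
    where
    join : ∀ b → joinSingleton c s b ≡ joinSingleton d s b
    join zero    = refl
    join (suc b) = cong (suc s *_) (c≗d (suc s) b)

module _ (xs : List A) (u : A → ℕ) (f : A → ℕ → ℕ → ℕ) where

  newSingleton-∑ : ∀ s b → newSingleton (λ s b → ∑[ x ∈ xs ] u x * f x s b) s b ≡ ∑[ x ∈ xs ] u x * newSingleton (f x) s b
  newSingleton-∑ zero    b = sym (∑-zero xs λ x → *-zeroʳ (u x))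
  newSingleton-∑ (suc s) b = refl

  joinSingleton-∑ : ∀ s b → joinSingleton (λ s b → ∑[ x ∈ xs ] u x * f x s b) s b ≡ ∑[ x ∈ xs ] u x * joinSingleton (f x) s b
  joinSingleton-∑ s zero    = sym (∑-zero xs λ x → *-zeroʳ (u x))
  joinSingleton-∑ s (suc b) = trans (*-distribˡ-∑ (suc s) xs _) (∑-cong xs λ x → x*[y*z]≡y*[x*z] (suc s) (u x) _)

  addElement-∑ : ∀ s b → addElement (λ s b → ∑[ x ∈ xs ] u x * f x s b) s b ≡ ∑[ x ∈ xs ] u x * addElement (f x) s b
  addElement-∑ s b = begin
    newSingleton total s b + joinSingleton total s b + b * total s b
      ≡⟨ cong₂ _+_ (cong₂ _+_ (newSingleton-∑ s b) (joinSingleton-∑ s b))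
                   (trans (*-distribˡ-∑ b xs _) (∑-cong xs λ x → x*[y*z]≡y*[x*z] b (u x) _)) ⟩
    (∑[ x ∈ xs ] u x * newSingleton (f x) s b) + (∑[ x ∈ xs ] u x * joinSingleton (f x) s b) + (∑[ x ∈ xs ] u x * (b * f x s b))
      ≡⟨ cong (_+ (∑[ x ∈ xs ] u x * (b * f x s b))) (∑-distrib-+ xs _ _) ⟨
    (∑[ x ∈ xs ] (u x * newSingleton (f x) s b + u x * joinSingleton (f x) s b)) + (∑[ x ∈ xs ] u x * (b * f x s b))
      ≡⟨ ∑-distrib-+ xs _ _ ⟨
    ∑[ x ∈ xs ] (u x * newSingleton (f x) s b + u x * joinSingleton (f x) s b + u x * (b * f x s b))
      ≡⟨ ∑-cong xs (λ x → trans (*-distribˡ-+ (u x) _ _) (cong (_+ u x * (b * f x s b)) (*-distribˡ-+ (u x) _ _))) ⟨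
    ∑[ x ∈ xs ] u x * addElement (f x) s b ∎
    where
    total : ℕ → ℕ → ℕ
    total s b = ∑[ x ∈ xs ] u x * f x s b

-- Dually, the sum of g over the statistics of the one-element extensions of a partition with
-- a singletons and c blocks of size ≥ 2.
extensions : (ℕ → ℕ → ℕ) → ℕ → ℕ → ℕ
extensions g a c = g (suc a) c + a * g (pred a) (suc c) + c * g a c

indicator : ℕ → ℕ → ℕ → ℕ → ℕ
indicator s b a c = ⟦ (a ≡ᵇ s) ∧ (c ≡ᵇ b) ⟧

extensions-indicator : ∀ s b a c → extensions (indicator s b) a c ≡ addElement (λ s b → indicator s b a c) s b
extensions-indicator s b a c = cong₂ _+_ (cong₂ _+_ (new s) (join b a)) (big c)
  where
  new : ∀ s → indicator s b (suc a) c ≡ newSingleton (λ s b → indicator s b a c) s b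
  new zero    = refl
  new (suc s) = refl
  join : ∀ b a → a * indicator s b (pred a) (suc c) ≡ joinSingleton (λ s b → indicator s b a c) s b
  join zero    a       = trans (cong (λ z → a * ⟦ z ⟧) (∧-zeroʳ (pred a ≡ᵇ s))) (*-zeroʳ a)
  join (suc b) zero    = sym (*-zeroʳ (suc s))
  join (suc b) (suc a) with a ≡ᵇ s in a≡s
  ... | true  = cong (λ z → suc z * ⟦ c ≡ᵇ b ⟧) (≡ᵇ⇒≡ a s (subst T (sym a≡s) _))
  ... | false = trans (*-zeroʳ (suc a)) (sym (*-zeroʳ (suc s)))
  big : ∀ c → c * indicator s b a c ≡ b * indicator s b a c
  big c with c ≡ᵇ b in c≡b
  ... | true  = cong (_* ⟦ (a ≡ᵇ s) ∧ true ⟧) (≡ᵇ⇒≡ c b (subst T (sym c≡b) _))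
  ... | false rewrite ∧-zeroʳ (a ≡ᵇ s) = trans (*-zeroʳ c) (sym (*-zeroʳ b))

module _ {N} (w : Vec (Fin N) N) (g : ℕ → ℕ → ℕ) where

  private
    ns = numSingletons w
    nb = numBigBlocks w

  join-weight : ∀ r → ⟦ isRep w r ⟧ * g (numSingletons (extend w (inject₁ r))) (numBigBlocks (extend w (inject₁ r))) ≡
    ⟦ isRep w r ∧ (blockSize w r ≡ᵇ 1) ⟧ * g (pred ns) (suc nb) + ⟦ isRep w r ∧ (2 ≤ᵇ blockSize w r) ⟧ * g ns nb
  join-weight r with isRep w r in rep
  ... | false = refl
  ... | true with blockSize w r in size | blockSize-rep w r rep
  ...   | suc zero    | _ = trans (cong₂ (λ a c → g a c + 0) (proj₁ stats) (proj₂ stats)) (sym (+-identityʳ _))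
    where stats = joinSingleton-stats w r rep size
  ...   | suc (suc c) | _ = cong₂ (λ a c → g a c + 0) (proj₁ stats) (proj₂ stats)
    where stats = joinBig-stats w r rep size

  extensions-weights : g (numSingletons (extend w (fromℕ N))) (numBigBlocks (extend w (fromℕ N)))
      + ∑[ r ∈ allFin N ] ⟦ isRep w r ⟧ * g (numSingletons (extend w (inject₁ r))) (numBigBlocks (extend w (inject₁ r)))
    ≡ extensions g ns nb
  extensions-weights = begin
    g (numSingletons (extend w (fromℕ N))) (numBigBlocks (extend w (fromℕ N)))
      + ∑[ r ∈ allFin N ] ⟦ isRep w r ⟧ * g (numSingletons (extend w (inject₁ r))) (numBigBlocks (extend w (inject₁ r)))
      ≡⟨ cong₂ _+_ (cong₂ g (numSingletons-newBlock w) (numBigBlocks-newBlock w)) (∑-cong (allFin N) join-weight) ⟩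
    g (suc ns) nb + ∑[ r ∈ allFin N ] (⟦ isRep w r ∧ (blockSize w r ≡ᵇ 1) ⟧ * g (pred ns) (suc nb) + ⟦ isRep w r ∧ (2 ≤ᵇ blockSize w r) ⟧ * g ns nb)
      ≡⟨ cong (g (suc ns) nb +_) (trans (∑-distrib-+ (allFin N) _ _) (cong₂ _+_ (∑-⟦⟧*-const _ (allFin N) _) (∑-⟦⟧*-const _ (allFin N) _))) ⟩
    g (suc ns) nb + (ns * g (pred ns) (suc nb) + nb * g ns nb)
      ≡⟨ +-assoc (g (suc ns) nb) _ _ ⟨
    extensions g ns nb ∎

numPartitions≡∑ : ∀ N s b → numPartitions N s b ≡ ∑[ v ∈ allVecs N N ] ⟦ IsPartition v ⟧ * indicator s b (numSingletons v) (numBigBlocks v)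
numPartitions≡∑ N s b = trans (count≡∑ _ (allVecs N N)) (∑-cong (allVecs N N) λ v → ⟦∧⟧ (IsPartition v) _)

numPartitions-suc : ∀ N s b → numPartitions (suc N) s b ≡ addElement (numPartitions N) s b
numPartitions-suc N s b = begin
  numPartitions (suc N) s b
    ≡⟨ numPartitions≡∑ (suc N) s b ⟩
  ∑[ v ∈ allVecs (suc N) (suc N) ] ⟦ IsPartition v ⟧ * indicator s b (numSingletons v) (numBigBlocks v)
    ≡⟨ ∑-partitions-suc N _ ⟩
  ∑[ w ∈ allVecs N N ] ⟦ IsPartition w ⟧ * _
    ≡⟨ ∑-cong (allVecs N N) (λ w → cong (⟦ IsPartition w ⟧ *_)
         (trans (extensions-weights w (indicator s b)) (extensions-indicator s b (numSingletons w) (numBigBlocks w)))) ⟩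
  ∑[ w ∈ allVecs N N ] ⟦ IsPartition w ⟧ * addElement (λ s b → indicator s b (numSingletons w) (numBigBlocks w)) s b
    ≡⟨ addElement-∑ (allVecs N N) (λ w → ⟦ IsPartition w ⟧) (λ w s b → indicator s b (numSingletons w) (numBigBlocks w)) s b ⟨
  addElement (λ s b → ∑[ w ∈ allVecs N N ] ⟦ IsPartition w ⟧ * indicator s b (numSingletons w) (numBigBlocks w)) s b
    ≡⟨ addElement-cong (λ s b → sym (numPartitions≡∑ N s b)) s b ⟩
  addElement (numPartitions N) s b ∎

-- Partitions in which 0 is a singleton

zeroInBigBlock : ∀ {N} → Vec (Fin (suc N)) (suc N) → Bool
zeroInBigBlock v = 2 ≤ᵇ blockSize v (lookup v fzero)

isolatedZero : ∀ {N} (v : Vec (Fin (suc N)) (suc N)) → IsPartition v ≡ true → zeroInBigBlock v ≡ false →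
  lookup v fzero ≡ fzero × blockSize v fzero ≡ 1
isolatedZero {N} v isPart isolated = v₀≡0 , size≡1 (blockSize v fzero) refl (blockSize-rep v fzero rep)
  where
  v₀≡0 : lookup v fzero ≡ fzero
  v₀≡0 = toℕ-injective (n≤0⇒n≡0 (≤ᵇ⇒≤ _ 0 (subst T (sym (proj₁ (∧≡true (all-allFin⇒ (suc N) _ isPart fzero)))) _)))
  rep : isRep v fzero ≡ true
  rep = trans (cong (_== fzero) v₀≡0) (==-refl (fzero {N}))
  size≡1 : ∀ c → blockSize v fzero ≡ c → 1 ≤ c → c ≡ 1
  size≡1 (suc zero)    _    _ = refl
  size≡1 (suc (suc c)) size _ with () ← trans (sym (trans (cong (λ z → 2 ≤ᵇ blockSize v z) v₀≡0) (cong (2 ≤ᵇ_) size))) isolated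

module _ {N} (w : Vec (Fin (suc N)) (suc N)) where

  zeroInBigBlock-extend : ∀ y → zeroInBigBlock (extend w y) ≡ (2 ≤ᵇ (blockSize w (lookup w fzero) + ⟦ y == inject₁ (lookup w fzero) ⟧))
  zeroInBigBlock-extend y = trans (cong (λ z → 2 ≤ᵇ blockSize (extend w y) z) (lookup-extend-inject₁ w y fzero))
                                  (cong (2 ≤ᵇ_) (blockSize-extend-inject₁ w y (lookup w fzero)))

  zeroInBigBlock-extend-big : zeroInBigBlock w ≡ true → ∀ y → zeroInBigBlock (extend w y) ≡ true
  zeroInBigBlock-extend-big big y = trans (zeroInBigBlock-extend y) (stays (blockSize w (lookup w fzero)) big)
    where
    stays : ∀ c → (2 ≤ᵇ c) ≡ true → (2 ≤ᵇ (c + ⟦ y == inject₁ (lookup w fzero) ⟧)) ≡ true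
    stays (suc (suc c)) _ = refl

  zeroInBigBlock-extend-isolated : IsPartition w ≡ true → zeroInBigBlock w ≡ false → ∀ y → zeroInBigBlock (extend w y) ≡ (y == fzero)
  zeroInBigBlock-extend-isolated isPart isolated y with isolatedZero w isPart isolated
  ... | v₀≡0 , size≡1 = begin
    zeroInBigBlock (extend w y)                                                   ≡⟨ zeroInBigBlock-extend y ⟩
    2 ≤ᵇ (blockSize w (lookup w fzero) + ⟦ y == inject₁ (lookup w fzero) ⟧)     ≡⟨ cong (λ z → 2 ≤ᵇ (blockSize w z + ⟦ y == inject₁ z ⟧)) v₀≡0 ⟩
    2 ≤ᵇ (blockSize w fzero + ⟦ y == fzero ⟧)                                    ≡⟨ cong (λ c → 2 ≤ᵇ (c + ⟦ y == fzero ⟧)) size≡1 ⟩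
    2 ≤ᵇ (1 + ⟦ y == fzero ⟧)                                                    ≡⟨ twoOrMore (y == fzero) ⟩
    y == fzero                                                                  ∎
    where
    twoOrMore : ∀ b → (2 ≤ᵇ (1 + ⟦ b ⟧)) ≡ b
    twoOrMore true  = refl
    twoOrMore false = refl

isolatedZeroWeight : ∀ {N} → (ℕ → ℕ → ℕ) → Vec (Fin (suc N)) (suc N) → ℕ
isolatedZeroWeight g v = ⟦ not (zeroInBigBlock v) ⟧ * g (pred (numSingletons v)) (numBigBlocks v)

module _ {N} (w : Vec (Fin (suc N)) (suc N)) (isPart : IsPartition w ≡ true) (isolated : zeroInBigBlock w ≡ false) where

  private
    facts = isolatedZero w isPart isolated
    rep₀ : isRep w fzero ≡ true
    rep₀ = trans (cong (_== fzero) (proj₁ facts)) (==-refl (fzero {N}))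
    singletonRep bigRep : Fin (suc N) → Bool
    singletonRep r = isRep w r ∧ (blockSize w r ≡ᵇ 1)
    bigRep       r = isRep w r ∧ (2 ≤ᵇ blockSize w r)
    ns = numSingletons w
    nb = numBigBlocks w

  numSingletons-isolatedZero : ns ≡ suc (count (λ r → singletonRep r ∧ not (r == fzero)) (allFin (suc N)))
  numSingletons-isolatedZero = begin
    ns                                  ≡⟨ count-except (suc N) singletonRep fzero ⟨
    k + ⟦ singletonRep fzero ⟧          ≡⟨ cong₂ (λ a c → k + ⟦ a ∧ (c ≡ᵇ 1) ⟧) rep₀ (proj₂ facts) ⟩
    k + 1                               ≡⟨ +-comm k 1 ⟩
    suc k                               ∎
    where k = count (λ r → singletonRep r ∧ not (r == fzero)) (allFin (suc N))

  numBigBlocks-isolatedZero : count (λ r → bigRep r ∧ not (r == fzero)) (allFin (suc N)) ≡ nb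
  numBigBlocks-isolatedZero = begin
    k                                   ≡⟨ +-identityʳ k ⟨
    k + 0                               ≡⟨ cong₂ (λ a c → k + ⟦ a ∧ (2 ≤ᵇ c) ⟧) rep₀ (proj₂ facts) ⟨
    k + ⟦ bigRep fzero ⟧                ≡⟨ count-except (suc N) bigRep fzero ⟩
    nb                                  ∎
    where k = count (λ r → bigRep r ∧ not (r == fzero)) (allFin (suc N))

  module _ (g : ℕ → ℕ → ℕ) where

    isolatedZeroWeight-newBlock : isolatedZeroWeight g (extend w (fromℕ (suc N))) ≡ g ns nb
    isolatedZeroWeight-newBlock = begin
      ⟦ not (zeroInBigBlock u) ⟧ * g (pred (numSingletons u)) (numBigBlocks u)
        ≡⟨ cong (λ b → ⟦ not b ⟧ * g (pred (numSingletons u)) (numBigBlocks u))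
                (trans (zeroInBigBlock-extend-isolated w isPart isolated (fromℕ (suc N))) (fromℕ==inject₁ (fzero {N}))) ⟩
      g (pred (numSingletons u)) (numBigBlocks u) + 0
        ≡⟨ +-identityʳ _ ⟩
      g (pred (numSingletons u)) (numBigBlocks u)
        ≡⟨ cong₂ (λ a c → g (pred a) c) (numSingletons-newBlock w) (numBigBlocks-newBlock w) ⟩
      g ns nb ∎
      where u = extend w (fromℕ (suc N))

    isolatedZeroWeight-join : ∀ r → ⟦ isRep w r ⟧ * isolatedZeroWeight g (extend w (inject₁ r)) ≡
      ⟦ singletonRep r ∧ not (r == fzero) ⟧ * g (pred (pred ns)) (suc nb) + ⟦ bigRep r ∧ not (r == fzero) ⟧ * g (pred ns) nb
    isolatedZeroWeight-join r = begin
      ⟦ isRep w r ⟧ * (⟦ not (zeroInBigBlock (extend w (inject₁ r))) ⟧ * g (pred ns′) nb′)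
        ≡⟨ cong (λ b → ⟦ isRep w r ⟧ * (⟦ not b ⟧ * g (pred ns′) nb′))
                (trans (zeroInBigBlock-extend-isolated w isPart isolated (inject₁ r)) (inject₁==inject₁ r fzero)) ⟩
      ⟦ isRep w r ⟧ * (⟦ not (r == fzero) ⟧ * g (pred ns′) nb′)
        ≡⟨ x*[y*z]≡y*[x*z] ⟦ isRep w r ⟧ ⟦ not (r == fzero) ⟧ (g (pred ns′) nb′) ⟩
      ⟦ not (r == fzero) ⟧ * (⟦ isRep w r ⟧ * g (pred ns′) nb′)
        ≡⟨ cong (⟦ not (r == fzero) ⟧ *_) (join-weight w (λ a c → g (pred a) c) r) ⟩
      ⟦ not (r == fzero) ⟧ * (⟦ singletonRep r ⟧ * g (pred (pred ns)) (suc nb) + ⟦ bigRep r ⟧ * g (pred ns) nb)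
        ≡⟨ *-distribˡ-+ ⟦ not (r == fzero) ⟧ _ _ ⟩
      ⟦ not (r == fzero) ⟧ * (⟦ singletonRep r ⟧ * g (pred (pred ns)) (suc nb)) + ⟦ not (r == fzero) ⟧ * (⟦ bigRep r ⟧ * g (pred ns) nb)
        ≡⟨ cong₂ _+_ (excluded (singletonRep r)) (excluded (bigRep r)) ⟩
      ⟦ singletonRep r ∧ not (r == fzero) ⟧ * g (pred (pred ns)) (suc nb) + ⟦ bigRep r ∧ not (r == fzero) ⟧ * g (pred ns) nb ∎
      where
      ns′ = numSingletons (extend w (inject₁ r))
      nb′ = numBigBlocks (extend w (inject₁ r))
      excluded : ∀ a {x} → ⟦ not (r == fzero) ⟧ * (⟦ a ⟧ * x) ≡ ⟦ a ∧ not (r == fzero) ⟧ * x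
      excluded a {x} = trans (sym (*-assoc ⟦ not (r == fzero) ⟧ ⟦ a ⟧ x))
                             (cong (_* x) (trans (*-comm ⟦ not (r == fzero) ⟧ ⟦ a ⟧) (sym (⟦∧⟧ a (not (r == fzero))))))

    isolatedZeroWeight-extensions :
      isolatedZeroWeight g (extend w (fromℕ (suc N))) + ∑[ r ∈ allFin (suc N) ] ⟦ isRep w r ⟧ * isolatedZeroWeight g (extend w (inject₁ r))
      ≡ extensions g (pred ns) nb
    isolatedZeroWeight-extensions = begin
      isolatedZeroWeight g (extend w (fromℕ (suc N))) + ∑[ r ∈ allFin (suc N) ] ⟦ isRep w r ⟧ * isolatedZeroWeight g (extend w (inject₁ r))
        ≡⟨ cong₂ _+_ isolatedZeroWeight-newBlock (trans (∑-cong (allFin (suc N)) isolatedZeroWeight-join)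
                                                         (∑-distrib-+ (allFin (suc N)) (λ r → ⟦ singletonRep r ∧ not (r == fzero) ⟧ * g (pred (pred ns)) (suc nb))
                                                                                       (λ r → ⟦ bigRep r ∧ not (r == fzero) ⟧ * g (pred ns) nb))) ⟩
      g ns nb + ((∑[ r ∈ allFin (suc N) ] ⟦ singletonRep r ∧ not (r == fzero) ⟧ * g (pred (pred ns)) (suc nb))
                 + (∑[ r ∈ allFin (suc N) ] ⟦ bigRep r ∧ not (r == fzero) ⟧ * g (pred ns) nb))
        ≡⟨ cong (g ns nb +_) (cong₂ _+_ (∑-⟦⟧*-const (λ r → singletonRep r ∧ not (r == fzero)) (allFin (suc N)) _)
                                        (∑-⟦⟧*-const (λ r → bigRep r ∧ not (r == fzero)) (allFin (suc N)) _)) ⟩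
      g ns nb + (k * g (pred (pred ns)) (suc nb) + count (λ r → bigRep r ∧ not (r == fzero)) (allFin (suc N)) * g (pred ns) nb)
        ≡⟨ cong (λ c → g ns nb + (k * g (pred (pred ns)) (suc nb) + c * g (pred ns) nb)) numBigBlocks-isolatedZero ⟩
      g ns nb + (k * g (pred (pred ns)) (suc nb) + nb * g (pred ns) nb)
        ≡⟨ cong (λ n → g n nb + (k * g (pred (pred n)) (suc nb) + nb * g (pred n) nb)) numSingletons-isolatedZero ⟩
      g (suc k) nb + (k * g (pred k) (suc nb) + nb * g k nb)
        ≡⟨ +-assoc (g (suc k) nb) _ _ ⟨
      extensions g k nb
        ≡⟨ cong (λ n → extensions g (pred n) nb) numSingletons-isolatedZero ⟨
      extensions g (pred ns) nb ∎
      where k = count (λ r → singletonRep r ∧ not (r == fzero)) (allFin (suc N))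

isolatedZeroWeight-big : ∀ {N} g (v : Vec (Fin (suc N)) (suc N)) → zeroInBigBlock v ≡ true → isolatedZeroWeight g v ≡ 0
isolatedZeroWeight-big g v big rewrite big = refl

extensions-isolatedZeroWeight : ∀ {N} (w : Vec (Fin (suc N)) (suc N)) g →
  ⟦ IsPartition w ⟧ * (isolatedZeroWeight g (extend w (fromℕ (suc N))) + ∑[ r ∈ allFin (suc N) ] ⟦ isRep w r ⟧ * isolatedZeroWeight g (extend w (inject₁ r)))
  ≡ ⟦ IsPartition w ⟧ * isolatedZeroWeight (extensions g) w
extensions-isolatedZeroWeight {N} w g = ⟦⟧*-cong (IsPartition w) cases
  where
  cases : IsPartition w ≡ true →
    isolatedZeroWeight g (extend w (fromℕ (suc N))) + ∑[ r ∈ allFin (suc N) ] ⟦ isRep w r ⟧ * isolatedZeroWeight g (extend w (inject₁ r))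
    ≡ isolatedZeroWeight (extensions g) w
  cases isPart with zeroInBigBlock w in zf
  ... | true  = cong₂ _+_ (isolatedZeroWeight-big g (extend w (fromℕ (suc N))) (zeroInBigBlock-extend-big w zf (fromℕ (suc N))))
                  (∑-zero (allFin (suc N)) λ r → trans (cong (⟦ isRep w r ⟧ *_) (isolatedZeroWeight-big g (extend w (inject₁ r)) (zeroInBigBlock-extend-big w zf (inject₁ r))))
                                                       (*-zeroʳ ⟦ isRep w r ⟧))
  ... | false = trans (isolatedZeroWeight-extensions w isPart zf g) (sym (+-identityʳ _))

-- Partitions of Fin (suc N) having {0} as a block, counted by their other singletons and their blocks of size ≥ 2.
isolatedZeroPartitions : ℕ → ℕ → ℕ → ℕ
isolatedZeroPartitions N s b = ∑[ v ∈ allVecs (suc N) (suc N) ] ⟦ IsPartition v ⟧ * isolatedZeroWeight (indicator s b) v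

isolatedZeroPartitions-suc : ∀ N s b → isolatedZeroPartitions (suc N) s b ≡ addElement (isolatedZeroPartitions N) s b
isolatedZeroPartitions-suc N s b = begin
  isolatedZeroPartitions (suc N) s b
    ≡⟨ ∑-partitions-suc (suc N) _ ⟩
  ∑[ w ∈ vs ] ⟦ IsPartition w ⟧ * _
    ≡⟨ ∑-cong vs (λ w → extensions-isolatedZeroWeight w (indicator s b)) ⟩
  ∑[ w ∈ vs ] ⟦ IsPartition w ⟧ * isolatedZeroWeight (extensions (indicator s b)) w
    ≡⟨ ∑-cong vs (λ w → trans (cong (λ x → ⟦ IsPartition w ⟧ * (⟦ not (zeroInBigBlock w) ⟧ * x)) (extensions-indicator s b _ _))
                              (sym (*-assoc ⟦ IsPartition w ⟧ _ _))) ⟩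
  ∑[ w ∈ vs ] (⟦ IsPartition w ⟧ * ⟦ not (zeroInBigBlock w) ⟧) * addElement (λ s b → indicator s b (pred (numSingletons w)) (numBigBlocks w)) s b
    ≡⟨ addElement-∑ vs (λ w → ⟦ IsPartition w ⟧ * ⟦ not (zeroInBigBlock w) ⟧) (λ w s b → indicator s b (pred (numSingletons w)) (numBigBlocks w)) s b ⟨
  addElement (λ s b → ∑[ w ∈ vs ] (⟦ IsPartition w ⟧ * ⟦ not (zeroInBigBlock w) ⟧) * indicator s b (pred (numSingletons w)) (numBigBlocks w)) s b
    ≡⟨ addElement-cong (λ s b → ∑-cong vs λ w → *-assoc ⟦ IsPartition w ⟧ _ _) s b ⟩
  addElement (isolatedZeroPartitions N) s b ∎
  where vs = allVecs (suc N) (suc N)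

-- Binomial coefficients and associated Stirling numbers

binom : ℕ → ℕ → ℕ
binom n       zero    = 1
binom zero    (suc k) = 0
binom (suc n) (suc k) = binom n k + binom n (suc k)

binom≡C : ∀ n k → binom n k ≡ n C k
binom≡C n       zero    = refl
binom≡C zero    (suc k) = refl
binom≡C (suc n) (suc k) = trans (cong₂ _+_ (binom≡C n k) (binom≡C n (suc k))) (nCk+nC[k+1]≡[n+1]C[k+1] n k)

binom-vanish : ∀ {n k} → n < k → binom n k ≡ 0
binom-vanish {zero}  {suc k} _         = refl
binom-vanish {suc n} {suc k} (s≤s n<k) = cong₂ _+_ (binom-vanish n<k) (binom-vanish (m<n⇒m<1+n n<k))

binom-1 : ∀ n → binom n 1 ≡ n
binom-1 zero    = refl
binom-1 (suc n) = cong suc (binom-1 n)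

binom-absorb : ∀ n k → suc k * binom (suc n) (suc k) ≡ suc n * binom n k
binom-absorb zero    zero    = refl
binom-absorb zero    (suc k) = *-zeroʳ (suc (suc k))
binom-absorb (suc n) zero    = trans (+-identityʳ _) (trans (cong suc (binom-1 (suc n))) (sym (*-identityʳ _)))
binom-absorb (suc n) (suc k) = begin
  suc (suc k) * (binom (suc n) (suc k) + binom (suc n) (suc (suc k)))
    ≡⟨ split (suc k) (binom (suc n) (suc k)) _ ⟩
  suc k * binom (suc n) (suc k) + binom (suc n) (suc k) + suc (suc k) * binom (suc n) (suc (suc k))
    ≡⟨ cong₂ (λ a b → a + binom (suc n) (suc k) + b) (binom-absorb n k) (binom-absorb n (suc k)) ⟩
  suc n * binom n k + (binom n k + binom n (suc k)) + suc n * binom n (suc k)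
    ≡⟨ merge (suc n) (binom n k) (binom n (suc k)) ⟩
  suc (suc n) * (binom n k + binom n (suc k)) ∎
  where
  split : ∀ a x y → (1 + a) * (x + y) ≡ a * x + x + (1 + a) * y
  split = solve-∀
  merge : ∀ a x y → a * x + (x + y) + a * y ≡ (1 + a) * (x + y)
  merge = solve-∀

binom-absorb′ : ∀ k r → suc k * binom (k + r) (suc k) ≡ r * binom (k + r) k
binom-absorb′ k r = +-cancelˡ-≡ (suc k * binom (k + r) k) _ _ (begin
  suc k * binom (k + r) k + suc k * binom (k + r) (suc k) ≡⟨ *-distribˡ-+ (suc k) (binom (k + r) k) (binom (k + r) (suc k)) ⟨
  suc k * binom (suc (k + r)) (suc k)                      ≡⟨ binom-absorb (k + r) k ⟩
  suc (k + r) * binom (k + r) k                            ≡⟨ *-distribʳ-+ (binom (k + r) k) (suc k) r ⟩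
  suc k * binom (k + r) k + r * binom (k + r) k            ∎)

binom-factorial : ∀ k r → binom (k + r) k * (k ! * r !) ≡ (k + r) !
binom-factorial zero    r = trans (+-identityʳ _) (+-identityʳ _)
binom-factorial (suc k) r = begin
  binom (suc (k + r)) (suc k) * (suc k ! * r !)           ≡⟨ reassoc (binom (suc (k + r)) (suc k)) (suc k) (k !) (r !) ⟩
  suc k * binom (suc (k + r)) (suc k) * (k ! * r !)       ≡⟨ cong (_* (k ! * r !)) (binom-absorb (k + r) k) ⟩
  suc (k + r) * binom (k + r) k * (k ! * r !)             ≡⟨ *-assoc (suc (k + r)) (binom (k + r) k) (k ! * r !) ⟩
  suc (k + r) * (binom (k + r) k * (k ! * r !))           ≡⟨ cong (suc (k + r) *_) (binom-factorial k r) ⟩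
  suc (k + r) * (k + r) !                                 ∎
  where
  reassoc : ∀ b s f g → b * (s * f * g) ≡ s * b * (f * g)
  reassoc = solve-∀

binom-subset : ∀ a b c → binom (a + b) a * binom (a + (b + c)) (a + b) ≡ binom (a + (b + c)) a * binom (b + c) b
binom-subset a b c = *-cancelʳ-≡ _ _ (a ! * (b ! * c !)) {{m*n≢0 _ _ {{a !≢0}} {{m*n≢0 _ _ {{b !≢0}} {{c !≢0}}}}}} (begin
  binom (a + b) a * binom (a + (b + c)) (a + b) * (a ! * (b ! * c !))
    ≡⟨ regroup₁ (binom (a + b) a) (binom (a + (b + c)) (a + b)) (a !) (b !) (c !) ⟩
  binom (a + b) a * (a ! * b !) * (binom (a + (b + c)) (a + b) * c !)
    ≡⟨ cong (_* (binom (a + (b + c)) (a + b) * c !)) (binom-factorial a b) ⟩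
  (a + b) ! * (binom (a + (b + c)) (a + b) * c !)
    ≡⟨ x*[y*z]≡y*[x*z] ((a + b) !) (binom (a + (b + c)) (a + b)) (c !) ⟩
  binom (a + (b + c)) (a + b) * ((a + b) ! * c !)
    ≡⟨ cong (λ n → binom n (a + b) * ((a + b) ! * c !)) (+-assoc a b c) ⟨
  binom ((a + b) + c) (a + b) * ((a + b) ! * c !)
    ≡⟨ binom-factorial (a + b) c ⟩
  ((a + b) + c) !
    ≡⟨ cong _! (+-assoc a b c) ⟩
  (a + (b + c)) !
    ≡⟨ binom-factorial a (b + c) ⟨
  binom (a + (b + c)) a * (a ! * (b + c) !)
    ≡⟨ cong (λ z → binom (a + (b + c)) a * (a ! * z)) (binom-factorial b c) ⟨
  binom (a + (b + c)) a * (a ! * (binom (b + c) b * (b ! * c !)))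
    ≡⟨ regroup₂ (binom (a + (b + c)) a) (a !) (binom (b + c) b) (b ! * c !) ⟩
  binom (a + (b + c)) a * binom (b + c) b * (a ! * (b ! * c !)) ∎)
  where
  regroup₁ : ∀ x y p q r → x * y * (p * (q * r)) ≡ x * (p * q) * (y * r)
  regroup₁ = solve-∀
  regroup₂ : ∀ x p y q → x * (p * (y * q)) ≡ x * y * (p * q)
  regroup₂ = solve-∀

binom-subset′ : ∀ i M t → binom (i + suc t) i * binom (i + M) (i + suc t) ≡ binom (i + M) i * binom M (suc t)
binom-subset′ i M t with suc t ≤? M
... | yes t<M with m≤n⇒∃[o]m+o≡n t<M
...   | r , refl = binom-subset i (suc t) r
binom-subset′ i M t | no t≮M rewrite binom-vanish (≰⇒> t≮M) | binom-vanish (+-monoʳ-< i (≰⇒> t≮M)) =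
  trans (*-zeroʳ (binom (i + suc t) i)) (sym (*-zeroʳ (binom (i + M) i)))

-- The associated Stirling numbers {x over k}_{≥2}, by their recurrence on the block of the last element.
assocStirling : ℕ → ℕ → ℕ
assocStirling zero          zero    = 1
assocStirling zero          (suc k) = 0
assocStirling (suc zero)    k       = 0
assocStirling (suc (suc x)) zero    = 0
assocStirling (suc (suc x)) (suc k) = suc k * assocStirling (suc x) (suc k) + suc x * assocStirling x k

assocStirling-suc-zero : ∀ x → assocStirling (suc x) 0 ≡ 0
assocStirling-suc-zero zero    = refl
assocStirling-suc-zero (suc x) = refl

assocStirling-suc : ∀ x k → assocStirling (suc x) (suc k) ≡ suc k * assocStirling x (suc k) + x * assocStirling (pred x) k
assocStirling-suc zero    k = sym (trans (+-identityʳ _) (*-zeroʳ (suc k)))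
assocStirling-suc (suc x) k = refl

assocStirling-vanish : ∀ {x k} → x < k + k → assocStirling x k ≡ 0
assocStirling-vanish {zero}        {suc k} _ = refl
assocStirling-vanish {suc zero}    {k}     _ = refl
assocStirling-vanish {suc (suc x)} {zero}  ()
assocStirling-vanish {suc (suc x)} {suc k} (s≤s x<2k) = cong₂ _+_
  (trans (cong (suc k *_) (assocStirling-vanish (<-trans (n<1+n _) (s≤s x<2k)))) (*-zeroʳ (suc k)))
  (trans (cong (suc x *_) (assocStirling-vanish (≤-pred (subst (suc (suc x) ≤_) (+-suc k k) x<2k)))) (*-zeroʳ (suc x)))

partitionNumber : ℕ → ℕ → ℕ → ℕ
partitionNumber N s b = binom N s * assocStirling (N ∸ s) b

∸-suc : ∀ t x → (t + x) ∸ suc t ≡ pred x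
∸-suc zero    zero    = refl
∸-suc zero    (suc x) = refl
∸-suc (suc t) x       = ∸-suc t x

partitionNumber-join : ∀ t x b →
  binom (t + x) t * assocStirling (suc x) b ≡ joinSingleton (partitionNumber (t + x)) t b + b * partitionNumber (t + x) t b
partitionNumber-join t x zero rewrite assocStirling-suc-zero x = *-zeroʳ (binom (t + x) t)
partitionNumber-join t x (suc b) = begin
  binom (t + x) t * assocStirling (suc x) (suc b)
    ≡⟨ cong (binom (t + x) t *_) (assocStirling-suc x b) ⟩
  binom (t + x) t * (suc b * assocStirling x (suc b) + x * assocStirling (pred x) b)
    ≡⟨ distribute (binom (t + x) t) (suc b) (assocStirling x (suc b)) x (assocStirling (pred x) b) ⟩
  (x * binom (t + x) t) * assocStirling (pred x) b + suc b * (binom (t + x) t * assocStirling x (suc b))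
    ≡⟨ cong₂ (λ y z → y * assocStirling z b + suc b * (binom (t + x) t * assocStirling x (suc b))) (binom-absorb′ t x) (∸-suc t x) ⟨
  (suc t * binom (t + x) (suc t)) * assocStirling ((t + x) ∸ suc t) b + suc b * (binom (t + x) t * assocStirling x (suc b))
    ≡⟨ cong₂ (λ y z → y + suc b * (binom (t + x) t * assocStirling z (suc b))) (sym (*-assoc (suc t) (binom (t + x) (suc t)) (assocStirling ((t + x) ∸ suc t) b))) (m+n∸m≡n t x) ⟨
  joinSingleton (partitionNumber (t + x)) t (suc b) + suc b * partitionNumber (t + x) t (suc b) ∎
  where
  distribute : ∀ B a y c z → B * (a * y + c * z) ≡ (c * B) * z + a * (B * y)
  distribute = solve-∀

partitionNumber-joinSingleton : ∀ N s b →
  binom N (suc s) * assocStirling (N ∸ s) b ≡ joinSingleton (partitionNumber N) (suc s) b + b * partitionNumber N (suc s) b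
partitionNumber-joinSingleton N s b with suc s ≤? N
... | yes s<N with m≤n⇒∃[o]m+o≡n s<N
...   | x , refl = trans (cong (λ n → binom (suc s + x) (suc s) * assocStirling n b) (trans (cong (_∸ s) (sym (+-suc s x))) (m+n∸m≡n s (suc x))))
                         (partitionNumber-join (suc s) x b)
partitionNumber-joinSingleton N s b | no s≮N rewrite binom-vanish (≰⇒> s≮N) = sym (cong₂ _+_ (nothingToJoin b) (*-zeroʳ b))
  where
  nothingToJoin : ∀ b → joinSingleton (partitionNumber N) (suc s) b ≡ 0
  nothingToJoin zero    = refl
  nothingToJoin (suc b) rewrite binom-vanish (m<n⇒m<1+n (≰⇒> s≮N)) = *-zeroʳ (suc (suc s))

partitionNumber-suc : ∀ N s b → partitionNumber (suc N) s b ≡ addElement (partitionNumber N) s b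
partitionNumber-suc N zero    b = partitionNumber-join 0 N b
partitionNumber-suc N (suc s) b = begin
  (binom N s + binom N (suc s)) * assocStirling (N ∸ s) b
    ≡⟨ *-distribʳ-+ (assocStirling (N ∸ s) b) (binom N s) _ ⟩
  partitionNumber N s b + binom N (suc s) * assocStirling (N ∸ s) b
    ≡⟨ cong (partitionNumber N s b +_) (partitionNumber-joinSingleton N s b) ⟩
  partitionNumber N s b + (joinSingleton (partitionNumber N) (suc s) b + b * partitionNumber N (suc s) b)
    ≡⟨ +-assoc (partitionNumber N s b) _ _ ⟨
  addElement (partitionNumber N) (suc s) b ∎

addElement-unique : ∀ (c d : ℕ → ℕ → ℕ → ℕ) → (∀ s b → c 0 s b ≡ d 0 s b) →
  (∀ N s b → c (suc N) s b ≡ addElement (c N) s b) → (∀ N s b → d (suc N) s b ≡ addElement (d N) s b) →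
  ∀ N s b → c N s b ≡ d N s b
addElement-unique c d base c-suc d-suc zero    s b = base s b
addElement-unique c d base c-suc d-suc (suc N) s b =
  trans (c-suc N s b) (trans (addElement-cong (addElement-unique c d base c-suc d-suc N) s b) (sym (d-suc N s b)))

numPartitions≡partitionNumber : ∀ N s b → numPartitions N s b ≡ partitionNumber N s b
numPartitions≡partitionNumber = addElement-unique numPartitions partitionNumber base numPartitions-suc partitionNumber-suc
  where
  base : ∀ s b → numPartitions 0 s b ≡ partitionNumber 0 s b
  base zero    zero    = refl
  base zero    (suc b) = refl
  base (suc s) b       = refl

isolatedZeroPartitions≡partitionNumber : ∀ N s b → isolatedZeroPartitions N s b ≡ partitionNumber N s b
isolatedZeroPartitions≡partitionNumber = addElement-unique isolatedZeroPartitions partitionNumber base isolatedZeroPartitions-suc partitionNumber-suc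
  where
  base : ∀ s b → isolatedZeroPartitions 0 s b ≡ partitionNumber 0 s b
  base zero    zero    = refl
  base zero    (suc b) = refl
  base (suc s) b       = refl

S₂≡assocStirling : ∀ x b → S₂ x b ≡ assocStirling x b
S₂≡assocStirling x b = trans (numPartitions≡partitionNumber x 0 b) (+-identityʳ _)

p≡partitionNumber : ∀ a b c → p a b c ≡ partitionNumber (a + b) c b
p≡partitionNumber a b c = cong₂ _*_ (sym (binom≡C (a + b) c)) (S₂≡assocStirling (a + b ∸ c) b)

newSingleton-indicator : ∀ s b n c → newSingleton (λ s b → indicator s b (pred (suc n)) c) s b ≡ indicator s b (suc n) c
newSingleton-indicator zero    b n c = refl
newSingleton-indicator (suc s) b n c = refl

-- isolatedZeroPartitions does not count the singleton {0} itself, hence the shift by newSingleton.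
Π₀card-complement : ∀ m k i → Π₀card m k i + newSingleton (isolatedZeroPartitions (m + k)) i (suc k) ≡ numPartitions (suc (m + k)) i (suc k)
Π₀card-complement m k i = begin
  Π₀card m k i + newSingleton (isolatedZeroPartitions n) i (suc k)
    ≡⟨ cong₂ _+_ (count≡∑ _ vs) (trans (newSingleton-cong reassociated i (suc k))
                                       (newSingleton-∑ vs (λ v → ⟦ IsPartition v ⟧ * ⟦ not (zeroInBigBlock v) ⟧) singletonsBesidesZero i (suc k))) ⟩
  (∑[ v ∈ vs ] ⟦ IsPartition v ∧ (numSingletons v ≡ᵇ i) ∧ (numBigBlocks v ≡ᵇ suc k) ∧ zeroInBigBlock v ⟧)
    + (∑[ v ∈ vs ] (⟦ IsPartition v ⟧ * ⟦ not (zeroInBigBlock v) ⟧) * newSingleton (singletonsBesidesZero v) i (suc k))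
    ≡⟨ ∑-distrib-+ vs _ _ ⟨
  ∑[ v ∈ vs ] (⟦ IsPartition v ∧ (numSingletons v ≡ᵇ i) ∧ (numBigBlocks v ≡ᵇ suc k) ∧ zeroInBigBlock v ⟧
               + (⟦ IsPartition v ⟧ * ⟦ not (zeroInBigBlock v) ⟧) * newSingleton (singletonsBesidesZero v) i (suc k))
    ≡⟨ ∑-cong vs split ⟩
  ∑[ v ∈ vs ] ⟦ IsPartition v ⟧ * indicator i (suc k) (numSingletons v) (numBigBlocks v)
    ≡⟨ numPartitions≡∑ (suc n) i (suc k) ⟨
  numPartitions (suc n) i (suc k) ∎
  where
  n = m + k
  vs = allVecs (suc n) (suc n)
  singletonsBesidesZero : Vec (Fin (suc n)) (suc n) → ℕ → ℕ → ℕ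
  singletonsBesidesZero v s b = indicator s b (pred (numSingletons v)) (numBigBlocks v)
  reassociated : ∀ s b → isolatedZeroPartitions n s b ≡ ∑[ v ∈ vs ] (⟦ IsPartition v ⟧ * ⟦ not (zeroInBigBlock v) ⟧) * singletonsBesidesZero v s b
  reassociated s b = ∑-cong vs λ v → sym (*-assoc ⟦ IsPartition v ⟧ _ _)
  split : ∀ v → ⟦ IsPartition v ∧ (numSingletons v ≡ᵇ i) ∧ (numBigBlocks v ≡ᵇ suc k) ∧ zeroInBigBlock v ⟧
                + (⟦ IsPartition v ⟧ * ⟦ not (zeroInBigBlock v) ⟧) * newSingleton (singletonsBesidesZero v) i (suc k)
              ≡ ⟦ IsPartition v ⟧ * indicator i (suc k) (numSingletons v) (numBigBlocks v)
  split v with IsPartition v in isPart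
  ... | false = refl
  ... | true with zeroInBigBlock v in zf
  ...   | true  = cong (λ b → ⟦ b ⟧ + 0) (cong ((numSingletons v ≡ᵇ i) ∧_) (∧-identityʳ _))
  ...   | false = begin
    ⟦ (numSingletons v ≡ᵇ i) ∧ (numBigBlocks v ≡ᵇ suc k) ∧ false ⟧ + (newSingleton (singletonsBesidesZero v) i (suc k) + 0)
      ≡⟨ cong₂ (λ b c → ⟦ b ⟧ + (c + 0)) (trans (cong ((numSingletons v ≡ᵇ i) ∧_) (∧-zeroʳ _)) (∧-zeroʳ _))
                                          (cong (λ a → newSingleton (λ s b → indicator s b (pred a) (numBigBlocks v)) i (suc k)) ns≡1+k) ⟩
    newSingleton (λ s b → indicator s b (pred (suc k′)) (numBigBlocks v)) i (suc k) + 0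
      ≡⟨ cong (_+ 0) (newSingleton-indicator i (suc k) k′ (numBigBlocks v)) ⟩
    indicator i (suc k) (suc k′) (numBigBlocks v) + 0
      ≡⟨ cong (λ a → indicator i (suc k) a (numBigBlocks v) + 0) ns≡1+k ⟨
    indicator i (suc k) (numSingletons v) (numBigBlocks v) + 0 ∎
    where
    ns≡1+k = numSingletons-isolatedZero v isPart zf
    k′ = count (λ r → (isRep v r ∧ (blockSize v r ≡ᵇ 1)) ∧ not (r == fzero)) (allFin (suc n))

Π₀card-formula : ∀ m k i → Π₀card m k i ≡ suc i * partitionNumber (m + k) (suc i) k + suc k * partitionNumber (m + k) i (suc k)
Π₀card-formula m k i = +-cancelʳ-≡ (newSingleton (partitionNumber n) i (suc k)) _ _ (begin
  Π₀card m k i + newSingleton (partitionNumber n) i (suc k)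
    ≡⟨ cong (Π₀card m k i +_) (newSingleton-cong (isolatedZeroPartitions≡partitionNumber n) i (suc k)) ⟨
  Π₀card m k i + newSingleton (isolatedZeroPartitions n) i (suc k)
    ≡⟨ Π₀card-complement m k i ⟩
  numPartitions (suc n) i (suc k)
    ≡⟨ numPartitions≡partitionNumber (suc n) i (suc k) ⟩
  partitionNumber (suc n) i (suc k)
    ≡⟨ partitionNumber-suc n i (suc k) ⟩
  newSingleton (partitionNumber n) i (suc k) + joinSingleton (partitionNumber n) i (suc k) + suc k * partitionNumber n i (suc k)
    ≡⟨ +-assoc (newSingleton (partitionNumber n) i (suc k)) _ _ ⟩
  newSingleton (partitionNumber n) i (suc k) + (suc i * partitionNumber n (suc i) k + suc k * partitionNumber n i (suc k))
    ≡⟨ +-comm (newSingleton (partitionNumber n) i (suc k)) _ ⟩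
  suc i * partitionNumber n (suc i) k + suc k * partitionNumber n i (suc k) + newSingleton (partitionNumber n) i (suc k) ∎)
  where n = m + k

-- The block of the new element contains t + 1 ≥ 1 old elements; the others form k blocks of size ≥ 2.
assocStirling-suc-∑ : ∀ M k → ∑[ t ∈ upTo M ] partitionNumber M (suc t) k ≡ assocStirling (suc M) (suc k)
assocStirling-suc-∑ zero    k = refl
assocStirling-suc-∑ (suc M) k = begin
  ∑[ t ∈ upTo (suc M) ] partitionNumber (suc M) (suc t) k
    ≡⟨ ∑-cong (upTo (suc M)) (λ t → *-distribʳ-+ (assocStirling (M ∸ t) k) (binom M t) _) ⟩
  ∑[ t ∈ upTo (suc M) ] (binom M t * assocStirling (M ∸ t) k + binom M (suc t) * assocStirling (M ∸ t) k)
    ≡⟨ ∑-distrib-+ (upTo (suc M)) (λ t → binom M t * assocStirling (M ∸ t) k) (λ t → binom M (suc t) * assocStirling (M ∸ t) k) ⟩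
  (∑[ t ∈ upTo (suc M) ] binom M t * assocStirling (M ∸ t) k) + (∑[ t ∈ upTo (suc M) ] binom M (suc t) * assocStirling (M ∸ t) k)
    ≡⟨ cong₂ _+_ (∑-upTo-suc M (λ t → binom M t * assocStirling (M ∸ t) k))
                 (trans (∑-cong (upTo (suc M)) (λ t → partitionNumber-joinSingleton M t k))
                        (∑-distrib-+ (upTo (suc M)) (λ t → joinSingleton (partitionNumber M) (suc t) k) (λ t → k * partitionNumber M (suc t) k))) ⟩
  (1 * assocStirling M k + S) + ((∑[ t ∈ upTo (suc M) ] joinSingleton (partitionNumber M) (suc t) k) + (∑[ t ∈ upTo (suc M) ] k * partitionNumber M (suc t) k))
    ≡⟨ cong₂ (λ a b → (1 * assocStirling M k + S) + (a + b)) (joins M k) (trans (sym (*-distribˡ-∑ k (upTo (suc M)) _)) (cong (k *_) (sym (∑-upTo-extend _ (n≤1+n M) tail)))) ⟩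
  (1 * assocStirling M k + S) + (M * assocStirling M k + k * S)
    ≡⟨ cong (λ j → (1 * assocStirling M k + j) + (M * assocStirling M k + k * j)) (assocStirling-suc-∑ M k) ⟩
  (1 * assocStirling M k + assocStirling (suc M) (suc k)) + (M * assocStirling M k + k * assocStirling (suc M) (suc k))
    ≡⟨ collect (assocStirling M k) (assocStirling (suc M) (suc k)) M k ⟩
  assocStirling (suc (suc M)) (suc k) ∎
  where
  S = ∑[ t ∈ upTo M ] partitionNumber M (suc t) k
  collect : ∀ a b M k → (1 * a + b) + (M * a + k * b) ≡ suc k * b + suc M * a
  collect = solve-∀
  tail : ∀ t → M ≤ t → partitionNumber M (suc t) k ≡ 0
  tail t M≤t = cong (_* assocStirling (M ∸ suc t) k) (binom-vanish (s≤s M≤t))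
  joins : ∀ M k → ∑[ t ∈ upTo (suc M) ] joinSingleton (partitionNumber M) (suc t) k ≡ M * assocStirling M k
  joins zero    zero    = refl
  joins zero    (suc k) = refl
  joins (suc M) zero    = trans (∑-zero (upTo (suc (suc M))) (λ _ → refl)) (sym (trans (cong (suc M *_) (assocStirling-suc-zero M)) (*-zeroʳ (suc M))))
  joins (suc M) (suc k) = begin
    ∑[ t ∈ upTo (suc (suc M)) ] suc (suc t) * (binom (suc M) (suc (suc t)) * assocStirling (suc M ∸ suc (suc t)) k)
      ≡⟨ ∑-cong (upTo (suc (suc M))) absorb ⟩
    ∑[ t ∈ upTo (suc (suc M)) ] suc M * partitionNumber M (suc t) k
      ≡⟨ *-distribˡ-∑ (suc M) (upTo (suc (suc M))) (λ t → partitionNumber M (suc t) k) ⟨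
    suc M * (∑[ t ∈ upTo (suc (suc M)) ] partitionNumber M (suc t) k)
      ≡⟨ cong (suc M *_) (∑-upTo-extend _ (m≤n⇒m≤1+n (n≤1+n M)) (λ t M≤t → cong (_* assocStirling (M ∸ suc t) k) (binom-vanish (s≤s M≤t)))) ⟨
    suc M * (∑[ t ∈ upTo M ] partitionNumber M (suc t) k)
      ≡⟨ cong (suc M *_) (assocStirling-suc-∑ M k) ⟩
    suc M * assocStirling (suc M) (suc k) ∎
    where
    absorb : ∀ t → suc (suc t) * (binom (suc M) (suc (suc t)) * assocStirling (M ∸ suc t) k) ≡ suc M * partitionNumber M (suc t) k
    absorb t = trans (sym (*-assoc (suc (suc t)) (binom (suc M) (suc (suc t))) (assocStirling (M ∸ suc t) k)))
                     (trans (cong (_* assocStirling (M ∸ suc t) k) (binom-absorb M (suc t))) (*-assoc (suc M) (binom M (suc t)) _))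

∑-binom-partitionNumber : ∀ n i k →
  ∑[ t ∈ upTo (n ∸ i) ] binom (suc i + t) i * partitionNumber n (suc i + t) k
    ≡ suc i * partitionNumber n (suc i) k + suc k * partitionNumber n i (suc k)
∑-binom-partitionNumber n i k with i ≤? n
... | no i≰n rewrite m≤n⇒m∸n≡0 (<⇒≤ (≰⇒> i≰n)) | binom-vanish (≰⇒> i≰n) | binom-vanish (m<n⇒m<1+n (≰⇒> i≰n)) =
  sym (cong₂ _+_ (*-zeroʳ (suc i)) (*-zeroʳ (suc k)))
... | yes i≤n with m≤n⇒∃[o]m+o≡n i≤n
...   | M , refl = begin
  ∑[ t ∈ upTo ((i + M) ∸ i) ] binom (suc i + t) i * partitionNumber (i + M) (suc i + t) k
    ≡⟨ cong (λ n → ∑[ t ∈ upTo n ] binom (suc i + t) i * partitionNumber (i + M) (suc i + t) k) (m+n∸m≡n i M) ⟩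
  ∑[ t ∈ upTo M ] binom (suc i + t) i * partitionNumber (i + M) (suc i + t) k
    ≡⟨ ∑-cong (upTo M) chooseFirst ⟩
  ∑[ t ∈ upTo M ] binom (i + M) i * partitionNumber M (suc t) k
    ≡⟨ *-distribˡ-∑ (binom (i + M) i) (upTo M) _ ⟨
  binom (i + M) i * (∑[ t ∈ upTo M ] partitionNumber M (suc t) k)
    ≡⟨ cong (binom (i + M) i *_) (assocStirling-suc-∑ M k) ⟩
  binom (i + M) i * assocStirling (suc M) (suc k)
    ≡⟨ partitionNumber-join i M (suc k) ⟩
  suc i * partitionNumber (i + M) (suc i) k + suc k * partitionNumber (i + M) i (suc k) ∎
  where
  chooseFirst : ∀ t → binom (suc i + t) i * partitionNumber (i + M) (suc i + t) k ≡ binom (i + M) i * partitionNumber M (suc t) k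
  chooseFirst t rewrite sym (+-suc i t) | [m+n]∸[m+o]≡n∸o i M (suc t) = begin
    binom (i + suc t) i * (binom (i + M) (i + suc t) * assocStirling (M ∸ suc t) k)
      ≡⟨ *-assoc (binom (i + suc t) i) _ _ ⟨
    binom (i + suc t) i * binom (i + M) (i + suc t) * assocStirling (M ∸ suc t) k
      ≡⟨ cong (_* assocStirling (M ∸ suc t) k) (binom-subset′ i M t) ⟩
    binom (i + M) i * binom M (suc t) * assocStirling (M ∸ suc t) k
      ≡⟨ *-assoc (binom (i + M) i) _ _ ⟩
    binom (i + M) i * partitionNumber M (suc t) k ∎

partitionNumber-vanish : ∀ m k j → m ∸ k < j → partitionNumber (m + k) j k ≡ 0
partitionNumber-vanish m k j m∸k<j with j ≤? m + k
... | no  j≰m+k = cong (_* assocStirling (m + k ∸ j) k) (binom-vanish (≰⇒> j≰m+k))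
... | yes j≤m+k = trans (cong (binom (m + k) j *_) (assocStirling-vanish remaining<2k)) (*-zeroʳ (binom (m + k) j))
  where
  m<k+j : m < k + j
  m<k+j = ≤-<-trans (m≤n+m∸n m k) (+-monoʳ-< k m∸k<j)
  remaining<2k : m + k ∸ j < k + k
  remaining<2k = +-cancelʳ-< j (m + k ∸ j) (k + k)
    (subst₂ _<_ (sym (m∸n+n≡m j≤m+k)) (rearrange k j) (+-monoˡ-< k m<k+j))
    where
    rearrange : ∀ k j → k + j + k ≡ k + k + j
    rearrange = solve-∀

∑-binom-p≡Π₀card : ∀ m k i → sumFromTo (suc i) (m ∸ k) (λ j → (j C i) * p m k j) ≡ Π₀card m k i
∑-binom-p≡Π₀card m k i = begin
  ∑[ t ∈ upTo ((m ∸ k) ∸ i) ] ((suc i + t) C i) * p m k (suc i + t)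
    ≡⟨ ∑-cong (upTo ((m ∸ k) ∸ i)) (λ t → cong₂ _*_ (sym (binom≡C (suc i + t) i)) (p≡partitionNumber m k (suc i + t))) ⟩
  ∑[ t ∈ upTo ((m ∸ k) ∸ i) ] binom (suc i + t) i * partitionNumber (m + k) (suc i + t) k
    ≡⟨ ∑-upTo-extend _ (∸-monoˡ-≤ i (≤-trans (m∸n≤m m k) (m≤m+n m k))) beyond ⟩
  ∑[ t ∈ upTo ((m + k) ∸ i) ] binom (suc i + t) i * partitionNumber (m + k) (suc i + t) k
    ≡⟨ ∑-binom-partitionNumber (m + k) i k ⟩
  suc i * partitionNumber (m + k) (suc i) k + suc k * partitionNumber (m + k) i (suc k)
    ≡⟨ Π₀card-formula m k i ⟨
  Π₀card m k i ∎
  where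
  beyond : ∀ t → (m ∸ k) ∸ i ≤ t → binom (suc i + t) i * partitionNumber (m + k) (suc i + t) k ≡ 0
  beyond t m∸k∸i≤t = trans (cong (binom (suc i + t) i *_) (partitionNumber-vanish m k (suc i + t)
                               (s≤s (≤-trans (m≤n+m∸n (m ∸ k) i) (+-monoʳ-≤ i m∸k∸i≤t)))))
                           (*-zeroʳ (binom (suc i + t) i))

Π₀card-suc : ∀ m k i → Π₀card (suc m) k i ≡ suc k * p m (suc k) i + (suc m + k) * p m k i
Π₀card-suc m k i = begin
  Π₀card (suc m) k i
    ≡⟨ Π₀card-formula (suc m) k i ⟩
  suc i * partitionNumber (suc m + k) (suc i) k + suc k * partitionNumber (suc m + k) i (suc k)
    ≡⟨ +-comm (suc i * partitionNumber (suc m + k) (suc i) k) _ ⟩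
  suc k * partitionNumber (suc (m + k)) i (suc k) + suc i * partitionNumber (suc (m + k)) (suc i) k
    ≡⟨ cong₂ _+_ (cong (λ n → suc k * partitionNumber n i (suc k)) (+-suc m k)) absorbed ⟨
  suc k * partitionNumber (m + suc k) i (suc k) + suc (m + k) * partitionNumber (m + k) i k
    ≡⟨ cong₂ _+_ (cong (suc k *_) (p≡partitionNumber m (suc k) i)) (cong (suc (m + k) *_) (p≡partitionNumber m k i)) ⟨
  suc k * p m (suc k) i + (suc m + k) * p m k i ∎
  where
  absorbed : suc (m + k) * partitionNumber (m + k) i k ≡ suc i * partitionNumber (suc (m + k)) (suc i) k
  absorbed = begin
    suc (m + k) * (binom (m + k) i * assocStirling (m + k ∸ i) k) ≡⟨ *-assoc (suc (m + k)) (binom (m + k) i) (assocStirling (m + k ∸ i) k) ⟨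
    suc (m + k) * binom (m + k) i * assocStirling (m + k ∸ i) k   ≡⟨ cong (_* assocStirling (m + k ∸ i) k) (binom-absorb (m + k) i) ⟨
    suc i * binom (suc (m + k)) (suc i) * assocStirling (m + k ∸ i) k ≡⟨ *-assoc (suc i) (binom (suc (m + k)) (suc i)) (assocStirling (m + k ∸ i) k) ⟩
    suc i * partitionNumber (suc (m + k)) (suc i) k ∎

proposition3p1 : (m k i : ℕ) → 1 ≤ m →
    (sumFromTo (suc i) (m ∸ k) (λ j → (j C i) * p m k j) ≡ Π₀card m k i)
    × (Π₀card m k i ≡ suc k * p (m ∸ 1) (suc k) i + (m + k) * p (m ∸ 1) k i)
proposition3p1 (suc m) k i _ = ∑-binom-p≡Π₀card (suc m) k i , Π₀card-suc m k i
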